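{- For each $n\geq1$, $\beta>0$, $J>0$, the partition function of the Ising model on the $n$-th Schreier graph $\Sigma_n$ of $H^{(3)}$ is $$Z_n=2^{3^n}\cosh(\beta J)^{\frac{3^{n+1}-3}{2}}\,\Gamma^{cl}_n(\tanh(\beta J)),$$ where the generating function of closed polygons of $\Sigma_n$ satisfies, as an identity of rational functions of $z$, $$\Gamma^{cl}_n(z)=z^{3^n}\prod_{k=1}^n\psi_k^{3^{n-k}}(z)\cdot(\psi_{n+1}(z)-1),$$ with $\psi_1(z)=\frac{z+1}{z}$ and $\psi_k(z)=\psi_{k-1}^2(z)-3\psi_{k-1}(z)+4$ for $k\geq 2$.
   Context: Vertices of the rooted ternary tree are finite words over $\{0,1,2\}$. The Hanoi Towers group $H^{(3)}$ is generated by the involutions $a,b,c$ with $a(0w)=1w$, $a(1w)=0w$, $a(2w)=2a(w)$; $b(0w)=2w$, $b(2w)=0w$, $b(1w)=1b(w)$; $c(1w)=2w$, $c(2w)=1w$, $c(0w)=0c(w)$. Its $n$-th Schreier graph $\Sigma_n$ has vertex set the $3^n$ words of length $n$, and for each $s\in\{a,b,c\}$ and each pair $\{u,s(u)\}$ with $u\neq s(u)$ one edge joining them, labeled $s$; loops are removed. A closed polygon is a subset of the edge set in which every vertex has even degree (empty set included); $\Gamma^{cl}_n(z)=\sum_X z^{|X|}$ over closed polygons $X$ of $\Sigma_n$. The Ising partition function with constant interaction $J$ at inverse temperature $\beta$ on a finite graph $Y$ is $Z=\sum_{\sigma\in\{\pm1\}^{Vert(Y)}}\exp\big(\beta J\sum_{\{i,j\}\in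 Edges(Y)}\sigma_i\sigma_j\big)$. -}

module Defs where

open import Level using (Level)
open import Data.Nat as ℕ using (ℕ; zero; suc)
open import Data.Fin using (Fin; zero; suc; toℕ)
open import Data.Vec using (Vec; []; _∷_)
open import Data.List using (List; []; _∷_; _++_; map; filterᵇ; length; foldr; concatMap)
open import Data.Integer using (+_)
open import Data.Bool using (Bool; true; false; if_then_else_; _∨_; _∧_)
open import Data.Product using (_×_; _,_; proj₁; proj₂)
open import Algebra.Bundles using (CommutativeRing)
open import Data.Rational as ℚ using (ℚ; 1/_; NonZero)

Word : ℕ → Set
Word n = Vec (Fin 3) n

data Gen : Set where
  a b c : Gen

pattern 𝟘 = zero
pattern 𝟙 = suc zero
pattern 𝟚 = suc (suc zero)

act : ∀ {n} → Gen → Word n → Word n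
act _ [] = []
act a (𝟘 ∷ w) = 𝟙 ∷ w
act a (𝟙 ∷ w) = 𝟘 ∷ w
act a (𝟚 ∷ w) = 𝟚 ∷ act a w
act b (𝟘 ∷ w) = 𝟚 ∷ w
act b (𝟚 ∷ w) = 𝟘 ∷ w
act b (𝟙 ∷ w) = 𝟙 ∷ act b w
act c (𝟙 ∷ w) = 𝟚 ∷ w
act c (𝟚 ∷ w) = 𝟙 ∷ w
act c (𝟘 ∷ w) = 𝟘 ∷ act c w

words : (n : ℕ) → List (Word n)
words zero = [] ∷ []
words (suc n) = concatMap (λ i → map (i ∷_) (words n)) (𝟘 ∷ 𝟙 ∷ 𝟚 ∷ [])

-- injective encoding of words as naturals (base 3), used to decide
-- equality of vertices and to pick one orientation of each edge
code : ∀ {n} → Word n → ℕ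
code [] = 0
code (i ∷ w) = toℕ i ℕ.+ 3 ℕ.* code w

-- The Schreier graph Σ_n: one edge labelled s for each pair {u, s u}
-- with u ≠ s u (loops removed).  The edge {u, s u} is represented by
-- (s , u) where u is the endpoint with the smaller code, so each
-- unordered pair yields exactly one edge per label.

Edge : ℕ → Set
Edge n = Gen × Word n

edges : (n : ℕ) → List (Edge n)
edges n = filterᵇ (λ e → code (proj₂ e) ℕ.<ᵇ code (act (proj₁ e) (proj₂ e)))
                  (concatMap (λ u → (a , u) ∷ (b , u) ∷ (c , u) ∷ []) (words n))

end₁ end₂ : ∀ {n} → Edge n → Word n
end₁ (s , u) = u
end₂ (s , u) = act s u

sameVertex : ∀ {n} → Word n → Word n → Bool
sameVertex u v = code u ℕ.≡ᵇ code v

incident : ∀ {n} → Word n → Edge n → Bool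
incident v e = sameVertex v (end₁ e) ∨ sameVertex v (end₂ e)

degree : ∀ {n} → Word n → List (Edge n) → ℕ
degree v X = length (filterᵇ (incident v) X)

isEven : ℕ → Bool
isEven zero = true
isEven (suc zero) = false
isEven (suc (suc k)) = isEven k

-- all sub-lists (= all subsets, as the list elements are distinct)
sublists : ∀ {A : Set} → List A → List (List A)
sublists [] = [] ∷ []
sublists (x ∷ xs) = let r = sublists xs in r ++ map (x ∷_) r

allᵇ : ∀ {A : Set} → (A → Bool) → List A → Bool
allᵇ p = foldr (λ x r → p x ∧ r) true

isClosed : ∀ {n} → List (Edge n) → Bool
isClosed {n} X = allᵇ (λ v → isEven (degree v X)) (words n)

closedPolygons : (n : ℕ) → List (List (Edge n))
closedPolygons n = filterᵇ isClosed (sublists (edges n))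

module _ {ℓ₁ ℓ₂ : Level} (R : CommutativeRing ℓ₁ ℓ₂) where
  open CommutativeRing R

  pow : Carrier → ℕ → Carrier
  pow z zero = 1#
  pow z (suc k) = z * pow z k

  sumR : List Carrier → Carrier
  sumR = foldr _+_ 0#

  prodR : List Carrier → Carrier
  prodR = foldr _*_ 1#

  Γcl : (n : ℕ) → Carrier → Carrier
  Γcl n z = sumR (map (λ X → pow z (length X)) (closedPolygons n))

  -- Ising partition function with Boltzmann weights
  --   x = exp(βJ) on an edge with equal spins, y = exp(-βJ) otherwise,
  -- i.e. Z = Σ_σ Π_{edges {i,j}} exp(βJ σ_i σ_j).
  -- A spin configuration σ is encoded by the set S of vertices with σ = -1.
  spinMinus : ∀ {n} → List (Word n) → Word n → Bool
  spinMinus S v = foldr (λ u r → sameVertex u v ∨ r) false S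

  agree : Bool → Bool → Bool
  agree true true = true
  agree false false = true
  agree _ _ = false

  isingZ : (n : ℕ) → (x y : Carrier) → Carrier
  isingZ n x y =
    sumR (map (λ S → prodR (map (λ e → if agree (spinMinus S (end₁ e)) (spinMinus S (end₂ e))
                                          then x else y)
                                (edges n)))
              (sublists (words n)))

powℚ : ℚ → ℕ → ℚ
powℚ z zero = ℚ.1ℚ
powℚ z (suc k) = z ℚ.* powℚ z k

-- ψ 1 z = (z+1)/z ; ψ k z = ψ_{k-1}(z)^2 - 3 ψ_{k-1}(z) + 4 for k ≥ 2.
-- (ψ 0 is never used; it is set to 0.)
ψ : ℕ → (z : ℚ) → .{{NonZero z}} → ℚ
ψ zero z = ℚ.0ℚ
ψ (suc zero) z = (z ℚ.+ ℚ.1ℚ) ℚ.* (1/ z)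
ψ (suc (suc k)) z = let p = ψ (suc k) z in
  p ℚ.* p ℚ.- (+ 3 ℚ./ 1) ℚ.* p ℚ.+ (+ 4 ℚ./ 1)

prodTo : ℕ → (ℕ → ℚ) → ℚ
prodTo zero f = ℚ.1ℚ
prodTo (suc m) f = prodTo m f ℚ.* f (suc m)

module Submission where

-- Writing each Boltzmann factor as c (1 ± t) and expanding the product over the edges, a set X
-- of edges survives the sum over spins exactly when every vertex has even degree in X, and then
-- contributes 2^{3^n} t^{|X|}; so Z_n = 2^{3^n} c^{|E_n|} Γ^cl_n(t), where |E_n| = (3^{n+1} - 3)/2
-- because each generator fixes one of the 3^n words and pairs up the others.
--
-- Σ_{n+1} is three copies of Σ_n (the words ending in 0, 1, 2) joined by three edges between
-- their corners i^n.  Inserting spins at prescribed corners into the spin sum selects the edge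
-- sets whose odd vertices are exactly those corners; by the handshake lemma and symmetry this
-- leaves two sums, G_n (no odd corner, G_n = 2^{3^n} Γ^cl_n) and D_n (two odd corners), and
-- gluing gives G_{n+1} = G_n³ + z³D_n³ and D_{n+1} = z D_n² G_n + z² D_n³.  For s_n = z D_n
-- these read G_{n+1} = G_n³ + s_n³ and s_{n+1} = s_n² (G_n + s_n), which are solved by
-- s_n = 2^{3^n} z^{3^n} ∏_k ψ_k^{3^{n-k}} and G_n = s_n (ψ_{n+1} - 1).

open import Defs
open import Data.Nat using (ℕ; _≤_)
import Data.Nat as N
open import Data.Product using (_×_)
open import Relation.Binary.PropositionalEquality using (_≡_)
open import Algebra.Bundles using (CommutativeRing)
open import Data.Rational using (ℚ; NonZero)
open import Data.Rational.Properties using (+-*-commutativeRing)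
import Data.Rational as Q
open import Function using (_∘_)
open import Data.Nat using (zero; suc; _<ᵇ_)
import Data.Nat.Properties as N
open import Data.Fin using (Fin; toℕ)
open import Data.Vec using (_∷_; _∷ʳ_)
import Data.Vec.Properties as Vec
open import Data.List using (List; []; _∷_; _++_; map; foldr; filterᵇ; length; concatMap)
import Data.List.Properties as List
open import Data.List.Membership.Propositional using (_∈_)
open import Data.List.Relation.Unary.Any using (here; there)
import Data.List.Relation.Unary.All as All
open import Data.List.Membership.Propositional.Properties using (∈-map⁻; ∈-++⁻)
open import Data.Sum using (inj₁; inj₂)
open import Data.List.Relation.Unary.AllPairs using (_∷_)
open import Data.List.Relation.Unary.Unique.Propositional using (Unique)
open import Data.List.Relation.Binary.Permutation.Propositional as ↭ using (_↭_; ↭-sym; ↭-trans; ↭-reflexive; ↭⇒↭ₛ′)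
import Data.List.Relation.Binary.Permutation.Propositional.Properties as ↭
import Data.List.Relation.Binary.Permutation.Setoid.Properties as ↭ₛ
open import Data.Bool using (Bool; true; false; if_then_else_; not; _xor_; _∨_)
open import Data.Bool.Properties using (∨-assoc; ∨-identityʳ)
open import Data.Product using (_,_)
open import Data.Empty using (⊥-elim)
open import Relation.Binary.PropositionalEquality as ≡ using (_≢_)

private variable A B : Set

concatMap-++-↭ : (f g : A → List B) (xs : List A) →
  concatMap (λ x → f x ++ g x) xs ↭ concatMap f xs ++ concatMap g xs
concatMap-++-↭ f g [] = ↭.refl
concatMap-++-↭ f g (x ∷ xs) = begin
  (f x ++ g x) ++ concatMap (λ x → f x ++ g x) xs   ↭⟨ ↭.++⁺ˡ (f x ++ g x) (concatMap-++-↭ f g xs) ⟩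
  (f x ++ g x) ++ (concatMap f xs ++ concatMap g xs) ≡⟨ List.++-assoc (f x) (g x) _ ⟩
  f x ++ (g x ++ (concatMap f xs ++ concatMap g xs)) ↭⟨ ↭.++⁺ˡ (f x) (↭.shifts (g x) (concatMap f xs)) ⟩
  f x ++ (concatMap f xs ++ (g x ++ concatMap g xs)) ≡⟨ List.++-assoc (f x) (concatMap f xs) _ ⟨
  (f x ++ concatMap f xs) ++ (g x ++ concatMap g xs) ∎
  where open ↭.PermutationReasoning

concatMap-[] : (xs : List A) → concatMap {B = B} (λ _ → []) xs ≡ []
concatMap-[] [] = ≡.refl
concatMap-[] (x ∷ xs) = concatMap-[] xs

concatMap-comm : ∀ {C : Set} (f : A → B → List C) (xs : List A) (ys : List B) →
  concatMap (λ x → concatMap (f x) ys) xs ↭ concatMap (λ y → concatMap (λ x → f x y) xs) ys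
concatMap-comm f [] ys = ↭-reflexive (≡.sym (concatMap-[] ys))
concatMap-comm f (x ∷ xs) ys =
  ↭-trans (↭.++⁺ˡ (concatMap (f x) ys) (concatMap-comm f xs ys))
          (↭-sym (concatMap-++-↭ (f x) (λ y → concatMap (λ x → f x y) xs) ys))

sublists-map : (h : A → B) (xs : List A) → sublists (map h xs) ≡ map (map h) (sublists xs)
sublists-map h [] = ≡.refl
sublists-map h (x ∷ xs) = begin
  sublists (map h xs) ++ map (h x ∷_) (sublists (map h xs))
    ≡⟨ ≡.cong (λ T → T ++ map (h x ∷_) T) (sublists-map h xs) ⟩
  map (map h) (sublists xs) ++ map (h x ∷_) (map (map h) (sublists xs))
    ≡⟨ ≡.cong (map (map h) (sublists xs) ++_) (List.map-∘ (sublists xs)) ⟨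
  map (map h) (sublists xs) ++ map (map h ∘ (x ∷_)) (sublists xs)
    ≡⟨ ≡.cong (map (map h) (sublists xs) ++_) (List.map-∘ (sublists xs)) ⟩
  map (map h) (sublists xs) ++ map (map h) (map (x ∷_) (sublists xs))
    ≡⟨ List.map-++ (map h) (sublists xs) _ ⟨
  map (map h) (sublists (x ∷ xs)) ∎
  where open ≡.≡-Reasoning

concatMap-↭ : {f g : A → List B} → (∀ x → f x ↭ g x) → (xs : List A) → concatMap f xs ↭ concatMap g xs
concatMap-↭ f↭g [] = ↭.refl
concatMap-↭ f↭g (x ∷ xs) = ↭.++⁺ (f↭g x) (concatMap-↭ f↭g xs)

∈-sublists⇒⊆ : (xs : List A) {S : List A} → S ∈ sublists xs → ∀ {u} → u ∈ S → u ∈ xs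
∈-sublists⇒⊆ [] (here ≡.refl) ()
∈-sublists⇒⊆ (x ∷ xs) S∈ u∈S with ∈-++⁻ (sublists xs) S∈
... | inj₁ S∈′ = there (∈-sublists⇒⊆ xs S∈′ u∈S)
... | inj₂ S∈′ with ∈-map⁻ (x ∷_) S∈′
... | S′ , S′∈ , ≡.refl with u∈S
... | here u≡x = here u≡x
... | there u∈S′ = there (∈-sublists⇒⊆ xs S′∈ u∈S′)

∈-filterᵇ⁻ : (p : A → Bool) (xs : List A) {x : A} → x ∈ filterᵇ p xs → p x ≡ true
∈-filterᵇ⁻ p (y ∷ xs) x∈ with p y in eq
∈-filterᵇ⁻ p (y ∷ xs) (here ≡.refl) | true = eq
∈-filterᵇ⁻ p (y ∷ xs) (there x∈) | true = ∈-filterᵇ⁻ p xs x∈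
... | false = ∈-filterᵇ⁻ p xs x∈

false≢true : false ≢ true
false≢true ()

isEven-suc : ∀ k → isEven (suc k) ≡ not (isEven k)
isEven-suc zero = ≡.refl
isEven-suc (suc zero) = ≡.refl
isEven-suc (suc (suc k)) = isEven-suc k

module ListSums {ℓ₁ ℓ₂} (R : CommutativeRing ℓ₁ ℓ₂) where
  open CommutativeRing R
  open import Relation.Binary.Reasoning.Setoid setoid
  open import Algebra.Properties.CommutativeSemigroup +-commutativeSemigroup using ()
    renaming (interchange to +-interchange)
  open import Algebra.Properties.CommutativeSemigroup *-commutativeSemigroup using ()
    renaming (interchange to *-interchange)

  ∑ ∏ : List A → (A → Carrier) → Carrier
  ∑ xs f = sumR R (map f xs)
  ∏ xs f = prodR R (map f xs)

  ∑-++ : (xs ys : List A) (f : A → Carrier) → ∑ (xs ++ ys) f ≈ ∑ xs f + ∑ ys f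
  ∑-++ [] ys f = sym (+-identityˡ _)
  ∑-++ (x ∷ xs) ys f = trans (+-congˡ (∑-++ xs ys f)) (sym (+-assoc _ _ _))

  ∏-++ : (xs ys : List A) (f : A → Carrier) → ∏ (xs ++ ys) f ≈ ∏ xs f * ∏ ys f
  ∏-++ [] ys f = sym (*-identityˡ _)
  ∏-++ (x ∷ xs) ys f = trans (*-congˡ (∏-++ xs ys f)) (sym (*-assoc _ _ _))

  ∑-cong-∈ : (xs : List A) {f g : A → Carrier} → (∀ x → x ∈ xs → f x ≈ g x) → ∑ xs f ≈ ∑ xs g
  ∑-cong-∈ [] f≈g = refl
  ∑-cong-∈ (x ∷ xs) f≈g = +-cong (f≈g x (here ≡.refl)) (∑-cong-∈ xs (λ y → f≈g y ∘ there))

  ∏-cong-∈ : (xs : List A) {f g : A → Carrier} → (∀ x → x ∈ xs → f x ≈ g x) → ∏ xs f ≈ ∏ xs g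
  ∏-cong-∈ [] f≈g = refl
  ∏-cong-∈ (x ∷ xs) f≈g = *-cong (f≈g x (here ≡.refl)) (∏-cong-∈ xs (λ y → f≈g y ∘ there))

  ∑-cong : (xs : List A) {f g : A → Carrier} → (∀ x → f x ≈ g x) → ∑ xs f ≈ ∑ xs g
  ∑-cong xs f≈g = ∑-cong-∈ xs (λ x _ → f≈g x)

  ∏-cong : (xs : List A) {f g : A → Carrier} → (∀ x → f x ≈ g x) → ∏ xs f ≈ ∏ xs g
  ∏-cong xs f≈g = ∏-cong-∈ xs (λ x _ → f≈g x)

  ∑-map : (h : A → B) (xs : List A) (f : B → Carrier) → ∑ (map h xs) f ≡ ∑ xs (f ∘ h)
  ∑-map h xs f = ≡.cong (sumR R) (≡.sym (List.map-∘ xs))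

  ∏-map : (h : A → B) (xs : List A) (f : B → Carrier) → ∏ (map h xs) f ≡ ∏ xs (f ∘ h)
  ∏-map h xs f = ≡.cong (prodR R) (≡.sym (List.map-∘ xs))

  ∏-concatMap : (k : A → List B) (xs : List A) (f : B → Carrier) →
    ∏ (concatMap k xs) f ≈ ∏ xs (λ x → ∏ (k x) f)
  ∏-concatMap k [] f = refl
  ∏-concatMap k (x ∷ xs) f = trans (∏-++ (k x) (concatMap k xs) f) (*-congˡ (∏-concatMap k xs f))

  ∑-zero : (xs : List A) → ∑ xs (λ _ → 0#) ≈ 0#
  ∑-zero [] = refl
  ∑-zero (x ∷ xs) = trans (+-identityˡ _) (∑-zero xs)

  ∏-one : (xs : List A) → ∏ xs (λ _ → 1#) ≈ 1#
  ∏-one [] = refl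
  ∏-one (x ∷ xs) = trans (*-identityˡ _) (∏-one xs)

  ∏-const : (xs : List A) (k : Carrier) → ∏ xs (λ _ → k) ≈ pow R k (length xs)
  ∏-const [] k = refl
  ∏-const (x ∷ xs) k = *-congˡ (∏-const xs k)

  ∑-+ : (xs : List A) (f g : A → Carrier) → ∑ xs (λ x → f x + g x) ≈ ∑ xs f + ∑ xs g
  ∑-+ [] f g = sym (+-identityˡ _)
  ∑-+ (x ∷ xs) f g = trans (+-congˡ (∑-+ xs f g)) (+-interchange _ _ _ _)

  ∏-* : (xs : List A) (f g : A → Carrier) → ∏ xs (λ x → f x * g x) ≈ ∏ xs f * ∏ xs g
  ∏-* [] f g = sym (*-identityˡ _)
  ∏-* (x ∷ xs) f g = trans (*-congˡ (∏-* xs f g)) (*-interchange _ _ _ _)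

  *-distribˡ-∑ : (xs : List A) (k : Carrier) (f : A → Carrier) → k * ∑ xs f ≈ ∑ xs (λ x → k * f x)
  *-distribˡ-∑ [] k f = zeroʳ k
  *-distribˡ-∑ (x ∷ xs) k f = trans (distribˡ _ _ _) (+-congˡ (*-distribˡ-∑ xs k f))

  *-distribʳ-∑ : (xs : List A) (k : Carrier) (f : A → Carrier) → ∑ xs f * k ≈ ∑ xs (λ x → f x * k)
  *-distribʳ-∑ xs k f = trans (*-comm _ _) (trans (*-distribˡ-∑ xs k f) (∑-cong xs (λ x → *-comm _ _)))

  ∑-comm : (xs : List A) (ys : List B) (f : A → B → Carrier) →
    ∑ xs (λ x → ∑ ys (f x)) ≈ ∑ ys (λ y → ∑ xs (λ x → f x y))
  ∑-comm [] ys f = sym (∑-zero ys)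
  ∑-comm (x ∷ xs) ys f = trans (+-congˡ (∑-comm xs ys f)) (sym (∑-+ ys (f x) _))

  ∑-filter : (p : A → Bool) (xs : List A) (f : A → Carrier) →
    ∑ (filterᵇ p xs) f ≈ ∑ xs (λ x → if p x then f x else 0#)
  ∑-filter p [] f = refl
  ∑-filter p (x ∷ xs) f with p x
  ... | true = +-congˡ (∑-filter p xs f)
  ... | false = trans (∑-filter p xs f) (sym (+-identityˡ _))

  ∏-filter : (p : A → Bool) (xs : List A) (f : A → Carrier) →
    ∏ (filterᵇ p xs) f ≈ ∏ xs (λ x → if p x then f x else 1#)
  ∏-filter p [] f = refl
  ∏-filter p (x ∷ xs) f with p x
  ... | true = *-congˡ (∏-filter p xs f)
  ... | false = trans (∏-filter p xs f) (sym (*-identityˡ _))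

  ∏-↭ : {xs ys : List A} (f : A → Carrier) → xs ↭ ys → ∏ xs f ≈ ∏ ys f
  ∏-↭ f p = ↭ₛ.foldr-commMonoid setoid *-isCommutativeMonoid (↭⇒↭ₛ′ isEquivalence (↭.map⁺ f p))

  ∑-sublists-∷ : (x : A) (xs : List A) (F : List A → Carrier) →
    ∑ (sublists (x ∷ xs)) F ≈ ∑ (sublists xs) F + ∑ (sublists xs) (λ S → F (x ∷ S))
  ∑-sublists-∷ x xs F = trans (∑-++ (sublists xs) _ F) (+-congˡ (reflexive (∑-map (x ∷_) (sublists xs) F)))

  ∑-sublists-++ : (xs ys : List A) (F : List A → Carrier) →
    ∑ (sublists (xs ++ ys)) F ≈ ∑ (sublists xs) (λ S → ∑ (sublists ys) (λ T → F (S ++ T)))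
  ∑-sublists-++ [] ys F = sym (+-identityʳ _)
  ∑-sublists-++ {A = A} (x ∷ xs) ys F = begin
    ∑ (sublists (x ∷ xs ++ ys)) F
      ≈⟨ ∑-sublists-∷ x (xs ++ ys) F ⟩
    ∑ (sublists (xs ++ ys)) F + ∑ (sublists (xs ++ ys)) (F ∘ (x ∷_))
      ≈⟨ +-cong (∑-sublists-++ xs ys F) (∑-sublists-++ xs ys (F ∘ (x ∷_))) ⟩
    ∑ (sublists xs) G + ∑ (sublists xs) (G ∘ (x ∷_))
      ≈⟨ ∑-sublists-∷ x xs G ⟨
    ∑ (sublists (x ∷ xs)) G ∎
    where
    G : List A → Carrier
    G S = ∑ (sublists ys) (λ T → F (S ++ T))

  ∑-sublists-map : (h : A → B) (xs : List A) (F : List B → Carrier) →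
    ∑ (sublists (map h xs)) F ≡ ∑ (sublists xs) (F ∘ map h)
  ∑-sublists-map h xs F = ≡.trans (≡.cong (λ T → ∑ T F) (sublists-map h xs)) (∑-map (map h) (sublists xs) F)

  ∑-sublists-map-++ : (h : A → B) (xs : List A) (ys : List B) (F : List B → Carrier) →
    ∑ (sublists (map h xs ++ ys)) F ≈ ∑ (sublists xs) (λ S → ∑ (sublists ys) (λ T → F (map h S ++ T)))
  ∑-sublists-map-++ h xs ys F = trans (∑-sublists-++ (map h xs) ys F) (reflexive (∑-sublists-map h xs _))

  ∑-sublists-↭ : {xs ys : List A} (F : List A → Carrier) →
    (∀ {S T} → S ↭ T → F S ≈ F T) → xs ↭ ys → ∑ (sublists xs) F ≈ ∑ (sublists ys) F
  ∑-sublists-↭ F F-↭ ↭.refl = refl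
  ∑-sublists-↭ F F-↭ (↭.prep {xs} {ys} x p) = begin
    ∑ (sublists (x ∷ xs)) F
      ≈⟨ ∑-sublists-∷ x xs F ⟩
    ∑ (sublists xs) F + ∑ (sublists xs) (F ∘ (x ∷_))
      ≈⟨ +-cong (∑-sublists-↭ F F-↭ p) (∑-sublists-↭ (F ∘ (x ∷_)) (F-↭ ∘ ↭.prep x) p) ⟩
    ∑ (sublists ys) F + ∑ (sublists ys) (F ∘ (x ∷_))
      ≈⟨ ∑-sublists-∷ x ys F ⟨
    ∑ (sublists (x ∷ ys)) F ∎
  ∑-sublists-↭ {A = A} F F-↭ (↭.swap {xs} {ys} x y p) = begin
    ∑ (sublists (x ∷ y ∷ xs)) F ≈⟨ ∑-sublists-∷∷ x y xs ⟩
    ∑ (sublists xs) (four x y)  ≈⟨ ∑-sublists-↭ (four x y) four-↭ p ⟩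
    ∑ (sublists ys) (four x y)  ≈⟨ ∑-cong (sublists ys) four-swap ⟩
    ∑ (sublists ys) (four y x)  ≈⟨ ∑-sublists-∷∷ y x ys ⟨
    ∑ (sublists (y ∷ x ∷ ys)) F ∎
    where
    four : A → A → List A → Carrier
    four u v S = (F S + F (v ∷ S)) + (F (u ∷ S) + F (u ∷ v ∷ S))
    four-↭ : ∀ {S T} → S ↭ T → four x y S ≈ four x y T
    four-↭ q = +-cong (+-cong (F-↭ q) (F-↭ (↭.prep y q))) (+-cong (F-↭ (↭.prep x q)) (F-↭ (↭.prep x (↭.prep y q))))
    four-swap : ∀ S → four x y S ≈ four y x S
    four-swap S = trans (+-interchange _ _ _ _) (+-congˡ (+-congˡ (F-↭ (↭.swap x y ↭.refl))))
    ∑-sublists-∷∷ : ∀ u v zs → ∑ (sublists (u ∷ v ∷ zs)) F ≈ ∑ (sublists zs) (four u v)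
    ∑-sublists-∷∷ u v zs = begin
      ∑ (sublists (u ∷ v ∷ zs)) F
        ≈⟨ ∑-sublists-∷ u (v ∷ zs) F ⟩
      ∑ (sublists (v ∷ zs)) F + ∑ (sublists (v ∷ zs)) (F ∘ (u ∷_))
        ≈⟨ +-cong (∑-sublists-∷ v zs F) (∑-sublists-∷ v zs (F ∘ (u ∷_))) ⟩
      (∑ (sublists zs) F + ∑ (sublists zs) (F ∘ (v ∷_))) + (∑ (sublists zs) (F ∘ (u ∷_)) + ∑ (sublists zs) (F ∘ (u ∷_) ∘ (v ∷_)))
        ≈⟨ +-cong (∑-+ (sublists zs) _ _) (∑-+ (sublists zs) _ _) ⟨
      ∑ (sublists zs) (λ S → F S + F (v ∷ S)) + ∑ (sublists zs) (λ S → F (u ∷ S) + F (u ∷ v ∷ S))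
        ≈⟨ ∑-+ (sublists zs) _ _ ⟨
      ∑ (sublists zs) (four u v) ∎
  ∑-sublists-↭ F F-↭ (↭.trans p q) = trans (∑-sublists-↭ F F-↭ p) (∑-sublists-↭ F F-↭ q)

  ∏-binomial : (z : Carrier) (E : List A) (g : A → Carrier) →
    ∏ E (λ e → 1# + z * g e) ≈ ∑ (sublists E) (λ X → pow R z (length X) * ∏ X g)
  ∏-binomial z [] g = sym (trans (+-identityʳ _) (*-identityʳ _))
  ∏-binomial {A = A} z (e ∷ E) g = begin
    (1# + z * g e) * ∏ E (λ e → 1# + z * g e)      ≈⟨ *-congˡ (∏-binomial z E g) ⟩
    (1# + z * g e) * ∑ (sublists E) term           ≈⟨ distribʳ _ _ _ ⟩
    1# * ∑ (sublists E) term + (z * g e) * ∑ (sublists E) term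
      ≈⟨ +-cong (*-identityˡ _) (*-distribˡ-∑ (sublists E) _ term) ⟩
    ∑ (sublists E) term + ∑ (sublists E) (λ X → (z * g e) * term X)
      ≈⟨ +-congˡ (∑-cong (sublists E) (λ X → *-interchange _ _ _ _)) ⟩
    ∑ (sublists E) term + ∑ (sublists E) (term ∘ (e ∷_)) ≈⟨ ∑-sublists-∷ e E term ⟨
    ∑ (sublists (e ∷ E)) term                      ∎
    where
    term : List A → Carrier
    term X = pow R z (length X) * ∏ X g

  ∏-comm : (xs : List A) (ys : List B) (f : A → B → Carrier) →
    ∏ xs (λ x → ∏ ys (f x)) ≈ ∏ ys (λ y → ∏ xs (λ x → f x y))
  ∏-comm [] ys f = sym (∏-one ys)
  ∏-comm (x ∷ xs) ys f = trans (*-congˡ (∏-comm xs ys f)) (sym (∏-* ys (f x) _))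

  ∑³-* : ∀ {C : Set} (xs : List A) (ys : List B) (zs : List C) k (f : A → Carrier) (g : B → Carrier) (h : C → Carrier) →
    ∑ xs (λ x → ∑ ys (λ y → ∑ zs (λ z → k * (f x * (g y * h z))))) ≈ k * (∑ xs f * (∑ ys g * ∑ zs h))
  ∑³-* xs ys zs k f g h = begin
    ∑ xs (λ x → ∑ ys (λ y → ∑ zs (λ z → k * (f x * (g y * h z)))))
      ≈⟨ ∑-cong xs (λ x → ∑-cong ys (λ y → pull zs k (pull zs (f x) (*-distribˡ-∑ zs (g y) h)))) ⟨
    ∑ xs (λ x → ∑ ys (λ y → k * (f x * (g y * ∑ zs h))))
      ≈⟨ ∑-cong xs (λ x → pull ys k (pull ys (f x) (*-distribʳ-∑ ys (∑ zs h) g))) ⟨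
    ∑ xs (λ x → k * (f x * (∑ ys g * ∑ zs h)))
      ≈⟨ pull xs k (*-distribʳ-∑ xs _ f) ⟨
    k * (∑ xs f * (∑ ys g * ∑ zs h)) ∎
    where
    pull : ∀ {D : Set} (ds : List D) {c} {φ : D → Carrier} k → c ≈ ∑ ds φ → k * c ≈ ∑ ds (λ d → k * φ d)
    pull ds {φ = φ} k c≈ = trans (*-congˡ c≈) (*-distribˡ-∑ ds k φ)

module Words where

  open import Data.Nat using (_+_; _*_; _^_; _<_)
  open import Data.Nat.DivMod using (_%_; [m+kn]%n≡m%n; m<n⇒m%n≡m)
  import Data.Fin.Properties as Fin
  open import Data.Vec using ([]; replicate)
  open import Data.List.Relation.Unary.All using ([])
  open import Data.List.Relation.Unary.AllPairs using ([])
  import Data.List.Relation.Unary.Unique.Propositional.Properties as Unique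
  open import Data.Bool using (_∧_)
  open import Data.Bool.Properties using (T-≡)
  open import Function.Bundles using (Equivalence)
  import Relation.Nullary.Reflects as Reflects
  open import Relation.Binary.PropositionalEquality using (refl; cong; cong₂; sym; trans)

  <ᵇ-true : ∀ {m n} → m < n → (m <ᵇ n) ≡ true
  <ᵇ-true {m} {n} m<n = Reflects.det (N.<ᵇ-reflects-< m n) (Reflects.ofʸ m<n)

  <ᵇ-false : ∀ {m n} → n ≤ m → (m <ᵇ n) ≡ false
  <ᵇ-false {m} {n} n≤m = Reflects.det (N.<ᵇ-reflects-< m n) (Reflects.ofⁿ (N.≤⇒≯ n≤m))

  +-<ᵇ : ∀ k m n → (k + m <ᵇ k + n) ≡ (m <ᵇ n)
  +-<ᵇ zero m n = refl
  +-<ᵇ (suc k) m n = +-<ᵇ k m n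

  +ʳ-<ᵇ : ∀ k m n → (m + k <ᵇ n + k) ≡ (m <ᵇ n)
  +ʳ-<ᵇ k m n = trans (cong₂ _<ᵇ_ (N.+-comm m k) (N.+-comm n k)) (+-<ᵇ k m n)

  *-<ᵇ : ∀ k .{{_ : N.NonZero k}} m n → (k * m <ᵇ k * n) ≡ (m <ᵇ n)
  *-<ᵇ k m n = Reflects.det (N.<ᵇ-reflects-< (k * m) (k * n))
    (Reflects.fromEquivalence (N.*-monoʳ-< k ∘ N.<ᵇ⇒< m n) (N.<⇒<ᵇ ∘ N.*-cancelˡ-< k m n))

  letters : List (Fin 3)
  letters = 𝟘 ∷ 𝟙 ∷ 𝟚 ∷ []

  actLetter : Gen → Fin 3 → Fin 3
  actLetter a 𝟘 = 𝟙
  actLetter a 𝟙 = 𝟘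
  actLetter a 𝟚 = 𝟚
  actLetter b 𝟘 = 𝟚
  actLetter b 𝟙 = 𝟙
  actLetter b 𝟚 = 𝟘
  actLetter c 𝟘 = 𝟘
  actLetter c 𝟙 = 𝟚
  actLetter c 𝟚 = 𝟙

  fixedLetter : Gen → Fin 3
  fixedLetter a = 𝟚
  fixedLetter b = 𝟙
  fixedLetter c = 𝟘

  isFixedLetter : Gen → Fin 3 → Bool
  isFixedLetter a 𝟚 = true
  isFixedLetter b 𝟙 = true
  isFixedLetter c 𝟘 = true
  isFixedLetter _ _ = false

  isFixedWord : ∀ {n} → Gen → Word n → Bool
  isFixedWord s [] = true
  isFixedWord s (i ∷ w) = isFixedLetter s i ∧ isFixedWord s w

  act-∷ʳ : ∀ s {n} (w : Word n) x →
    act s (w ∷ʳ x) ≡ act s w ∷ʳ (if isFixedWord s w then actLetter s x else x)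
  act-∷ʳ a [] 𝟘 = refl
  act-∷ʳ a [] 𝟙 = refl
  act-∷ʳ a [] 𝟚 = refl
  act-∷ʳ b [] 𝟘 = refl
  act-∷ʳ b [] 𝟙 = refl
  act-∷ʳ b [] 𝟚 = refl
  act-∷ʳ c [] 𝟘 = refl
  act-∷ʳ c [] 𝟙 = refl
  act-∷ʳ c [] 𝟚 = refl
  act-∷ʳ a (𝟘 ∷ w) x = refl
  act-∷ʳ a (𝟙 ∷ w) x = refl
  act-∷ʳ a (𝟚 ∷ w) x = cong (𝟚 ∷_) (act-∷ʳ a w x)
  act-∷ʳ b (𝟘 ∷ w) x = refl
  act-∷ʳ b (𝟙 ∷ w) x = cong (𝟙 ∷_) (act-∷ʳ b w x)
  act-∷ʳ b (𝟚 ∷ w) x = refl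
  act-∷ʳ c (𝟘 ∷ w) x = cong (𝟘 ∷_) (act-∷ʳ c w x)
  act-∷ʳ c (𝟙 ∷ w) x = refl
  act-∷ʳ c (𝟚 ∷ w) x = refl

  act-fixedWord : ∀ s {n} (w : Word n) → isFixedWord s w ≡ true → act s w ≡ w
  act-fixedWord s [] _ = refl
  act-fixedWord a (𝟚 ∷ w) fixed = cong (𝟚 ∷_) (act-fixedWord a w fixed)
  act-fixedWord b (𝟙 ∷ w) fixed = cong (𝟙 ∷_) (act-fixedWord b w fixed)
  act-fixedWord c (𝟘 ∷ w) fixed = cong (𝟘 ∷_) (act-fixedWord c w fixed)

  isFixedWord-replicate : ∀ s n → isFixedWord s (replicate n (fixedLetter s)) ≡ true
  isFixedWord-replicate s zero = refl
  isFixedWord-replicate a (suc n) = isFixedWord-replicate a n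
  isFixedWord-replicate b (suc n) = isFixedWord-replicate b n
  isFixedWord-replicate c (suc n) = isFixedWord-replicate c n

  generators : List Gen
  generators = a ∷ b ∷ c ∷ []

  corner : ∀ n → Fin 3 → Word n
  corner n i = replicate n i

  act-corner : ∀ s {n} x → act s (corner n (fixedLetter s) ∷ʳ x) ≡ corner n (fixedLetter s) ∷ʳ actLetter s x
  act-corner s {n} x = trans (act-∷ʳ s (corner n (fixedLetter s)) x)
    (cong₂ (λ w f → w ∷ʳ (if f then actLetter s x else x)) (act-fixedWord s _ fixed) fixed)
    where
    fixed : isFixedWord s (corner n (fixedLetter s)) ≡ true
    fixed = isFixedWord-replicate s n

  replicate-∷ʳ : ∀ {A : Set} n (x : A) → replicate (suc n) x ≡ replicate n x ∷ʳ x
  replicate-∷ʳ zero x = refl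
  replicate-∷ʳ (suc n) x = cong (x ∷_) (replicate-∷ʳ n x)

  code-∷ʳ : ∀ {n} (w : Word n) x → code (w ∷ʳ x) ≡ 3 ^ n * toℕ x + code w
  code-∷ʳ [] x = trans (N.+-identityʳ _) (sym (trans (N.+-identityʳ _) (N.*-identityˡ _)))
  code-∷ʳ {suc n} (i ∷ w) x = trans (cong (λ k → toℕ i + 3 * k) (code-∷ʳ w x)) (lemma (toℕ i) (3 ^ n) (toℕ x) (code w))
    where
    open import Data.Nat.Tactic.RingSolver
    lemma : ∀ i k x c → i + 3 * (k * x + c) ≡ 3 * k * x + (i + 3 * c)
    lemma = solve-∀

  base3-digit : ∀ (i j : Fin 3) p q → toℕ i + 3 * p ≡ toℕ j + 3 * q → i ≡ j × p ≡ q
  base3-digit i j p q eq =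
    i≡j , N.*-cancelˡ-≡ p q 3 (N.+-cancelˡ-≡ (toℕ i) _ _ (trans eq (cong (λ k → toℕ k + 3 * q) (sym i≡j))))
    where
    digit : ∀ (k : Fin 3) r → (toℕ k + 3 * r) % 3 ≡ toℕ k
    digit k r = trans (cong (λ t → (toℕ k + t) % 3) (N.*-comm 3 r))
                      (trans ([m+kn]%n≡m%n (toℕ k) r 3) (m<n⇒m%n≡m (Fin.toℕ<n k)))
    i≡j : i ≡ j
    i≡j = Fin.toℕ-injective (trans (sym (digit i p)) (trans (cong (_% 3) eq) (digit j q)))

  code-injective : ∀ {n} {u v : Word n} → code u ≡ code v → u ≡ v
  code-injective {u = []} {[]} _ = refl
  code-injective {u = i ∷ u} {j ∷ v} eq with base3-digit i j (code u) (code v) eq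
  ... | refl , eq′ = cong (i ∷_) (code-injective eq′)

  sameVertex⇒≡ : ∀ {n} (u v : Word n) → sameVertex u v ≡ true → u ≡ v
  sameVertex⇒≡ u v eq = code-injective (N.≡ᵇ⇒≡ (code u) (code v) (Equivalence.from T-≡ eq))

  ≡⇒sameVertex : ∀ {n} {u v : Word n} → u ≡ v → sameVertex u v ≡ true
  ≡⇒sameVertex {u = u} {v} u≡v = Equivalence.to T-≡ (N.≡⇒≡ᵇ (code u) (code v) (cong code u≡v))

  sameVertex-≢ : ∀ {n} {u v : Word n} → u ≢ v → sameVertex u v ≡ false
  sameVertex-≢ {u = u} {v} u≢v with sameVertex u v in eq
  ... | true = ⊥-elim (u≢v (sameVertex⇒≡ u v eq))
  ... | false = refl

  sameVertex-injective : ∀ {m n} (f : Word m → Word n) → (∀ {u v} → f u ≡ f v → u ≡ v) →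
    ∀ u v → sameVertex (f u) (f v) ≡ sameVertex u v
  sameVertex-injective f f-inj u v with sameVertex u v in eq
  ... | true = ≡⇒sameVertex (cong f (sameVertex⇒≡ u v eq))
  ... | false = sameVertex-≢ λ fu≡fv → false≢true (trans (sym eq) (≡⇒sameVertex (f-inj fu≡fv)))

  words-unique : ∀ n → Unique (words n)
  words-unique zero = [] ∷ []
  words-unique (suc n) = Unique.cartesianProductWith⁺ _∷_ Vec.∷-injective (Unique.allFin⁺ 3) (words-unique n)

  length-words : ∀ n → length (words n) ≡ 3 ^ n
  length-words zero = refl
  length-words (suc n) = trans (length-copies letters) (cong (3 *_) (length-words n))
    where
    length-copies : (is : List (Fin 3)) → length (concatMap (λ i → map (i ∷_) (words n)) is) ≡ length is * length (words n)
    length-copies [] = refl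
    length-copies (i ∷ is) = trans (List.length-++ (map (i ∷_) (words n)))
                                   (cong₂ _+_ (List.length-map (i ∷_) (words n)) (length-copies is))

  byLastLetter : ∀ {n} → (Fin 3 → List (Word n)) → List (Word (suc n))
  byLastLetter S = concatMap (λ i → map (_∷ʳ i) (S i)) letters

  triple : ∀ {A : Set} → A → A → A → Fin 3 → A
  triple x₀ x₁ x₂ 𝟘 = x₀
  triple x₀ x₁ x₂ 𝟙 = x₁
  triple x₀ x₁ x₂ 𝟚 = x₂

  words-↭-byLastLetter : ∀ n → words (suc n) ↭ byLastLetter (λ _ → words n)
  words-↭-byLastLetter zero = ↭.refl
  words-↭-byLastLetter (suc n) = begin
    concatMap (λ i → map (i ∷_) (words (suc n))) letters
      ↭⟨ concatMap-↭ (λ i → ↭.map⁺ (i ∷_) (words-↭-byLastLetter n)) letters ⟩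
    concatMap (λ i → map (i ∷_) (byLastLetter (λ _ → W))) letters
      ≡⟨ List.concatMap-cong (λ i → trans (List.map-concatMap (i ∷_) (λ x → map (_∷ʳ x) W) letters)
                                         (List.concatMap-cong (λ x → sym (List.map-∘ {g = i ∷_} {f = _∷ʳ x} W)) letters)) letters ⟩
    concatMap (λ i → concatMap (λ x → map (λ w → i ∷ (w ∷ʳ x)) W) letters) letters
      ↭⟨ concatMap-comm (λ i x → map (λ w → i ∷ (w ∷ʳ x)) W) letters letters ⟩
    concatMap (λ x → concatMap (λ i → map (λ w → i ∷ (w ∷ʳ x)) W) letters) letters
      ≡⟨ List.concatMap-cong (λ x → sym (trans (List.map-concatMap (_∷ʳ x) (λ i → map (i ∷_) W) letters)
                                              (List.concatMap-cong (λ i → sym (List.map-∘ {g = _∷ʳ x} {f = i ∷_} W)) letters))) letters ⟩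
    byLastLetter (λ _ → words (suc n)) ∎
    where
    open ↭.PermutationReasoning
    W : List (Word n)
    W = words n

open Words

module Edges where

  open import Data.Nat using (_+_; _*_; _^_; _∸_; z<s)
  open import Data.Nat.DivMod using (_/_; m*n/n≡m)
  open import Data.Bool.Properties using (T-≡)
  open import Data.Product using (proj₁; proj₂)
  open import Function.Bundles using (Equivalence)
  open import Relation.Binary.PropositionalEquality using (refl; cong; cong₂; sym; trans)

  indicator : Bool → ℕ
  indicator f = if f then 1 else 0

  count : ∀ {A : Set} → (A → Bool) → List A → ℕ
  count p xs = length (filterᵇ p xs)

  count-∷ : ∀ {A : Set} (p : A → Bool) x xs → count p (x ∷ xs) ≡ indicator (p x) + count p xs
  count-∷ p x xs with p x
  ... | true = refl
  ... | false = refl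

  count-++ : ∀ {A : Set} (p : A → Bool) xs ys → count p (xs ++ ys) ≡ count p xs + count p ys
  count-++ p [] ys = refl
  count-++ p (x ∷ xs) ys with p x
  ... | true = cong suc (count-++ p xs ys)
  ... | false = count-++ p xs ys

  count-map : ∀ {A B : Set} (p : B → Bool) (f : A → B) xs → count p (map f xs) ≡ count (p ∘ f) xs
  count-map p f [] = refl
  count-map p f (x ∷ xs) =
    trans (count-∷ p (f x) (map f xs)) (trans (cong (indicator (p (f x)) +_) (count-map p f xs)) (sym (count-∷ (p ∘ f) x xs)))

  count-cong : ∀ {A : Set} {p q : A → Bool} → (∀ x → p x ≡ q x) → ∀ xs → count p xs ≡ count q xs
  count-cong p≗q [] = refl
  count-cong {p = p} {q} p≗q (x ∷ xs) =
    trans (count-∷ p x xs) (trans (cong₂ (λ f k → indicator f + k) (p≗q x) (count-cong p≗q xs)) (sym (count-∷ q x xs)))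

  count-true : ∀ {A : Set} {p : A → Bool} → (∀ x → p x ≡ true) → ∀ xs → count p xs ≡ length xs
  count-true always [] = refl
  count-true {p = p} always (x ∷ xs) =
    trans (count-∷ p x xs) (cong₂ (λ f k → indicator f + k) (always x) (count-true always xs))

  count-false : ∀ {A : Set} {p : A → Bool} → (∀ x → p x ≡ false) → ∀ xs → count p xs ≡ 0
  count-false never [] = refl
  count-false {p = p} never (x ∷ xs) =
    trans (count-∷ p x xs) (cong₂ (λ f k → indicator f + k) (never x) (count-false never xs))

  ascends : ∀ {n} → Gen → Word n → Bool
  ascends s u = code u <ᵇ code (act s u)

  candidates : ∀ {n} → Word n → List (Edge n)
  candidates u = (a , u) ∷ (b , u) ∷ (c , u) ∷ []

  count-edges : ∀ {n} (W : List (Word n)) →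
    count (λ e → ascends (proj₁ e) (proj₂ e)) (concatMap candidates W)
      ≡ count (ascends a) W + (count (ascends b) W + count (ascends c) W)
  count-edges [] = refl
  count-edges (u ∷ W) = begin
    count ascendingEdge (candidates u ++ concatMap candidates W)
      ≡⟨ count-++ ascendingEdge (candidates u) _ ⟩
    count ascendingEdge (candidates u) + count ascendingEdge (concatMap candidates W)
      ≡⟨ cong₂ _+_ count-candidates (count-edges W) ⟩
    (ind a + (ind b + (ind c + 0))) + (count (ascends a) W + (count (ascends b) W + count (ascends c) W))
      ≡⟨ rearrange (ind a) (ind b) (ind c) _ _ _ ⟩
    (ind a + count (ascends a) W) + ((ind b + count (ascends b) W) + (ind c + count (ascends c) W))
      ≡⟨ cong₂ _+_ (count-∷ (ascends a) u W) (cong₂ _+_ (count-∷ (ascends b) u W) (count-∷ (ascends c) u W)) ⟨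
    count (ascends a) (u ∷ W) + (count (ascends b) (u ∷ W) + count (ascends c) (u ∷ W)) ∎
    where
    open ≡.≡-Reasoning
    ascendingEdge : Edge _ → Bool
    ascendingEdge e = ascends (proj₁ e) (proj₂ e)
    ind : Gen → ℕ
    ind s = indicator (ascends s u)
    count-candidates : count ascendingEdge (candidates u) ≡ ind a + (ind b + (ind c + 0))
    count-candidates = trans (count-∷ ascendingEdge (a , u) _) (cong (ind a +_)
                      (trans (count-∷ ascendingEdge (b , u) _) (cong (ind b +_) (count-∷ ascendingEdge (c , u) []))))
    rearrange : ∀ x y z p q r → (x + (y + (z + 0))) + (p + (q + r)) ≡ (x + p) + ((y + q) + (z + r))
    rearrange = solve-∀
      where open import Data.Nat.Tactic.RingSolver

  count-words-suc : ∀ {n} (p : Word (suc n) → Bool) → count p (words (suc n))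
    ≡ count (p ∘ (𝟘 ∷_)) (words n) + (count (p ∘ (𝟙 ∷_)) (words n) + (count (p ∘ (𝟚 ∷_)) (words n) + 0))
  count-words-suc {n} p =
    trans (count-++ p (map (𝟘 ∷_) W) _) (cong₂ _+_ (count-map p (𝟘 ∷_) W)
    (trans (count-++ p (map (𝟙 ∷_) W) _) (cong₂ _+_ (count-map p (𝟙 ∷_) W)
    (trans (count-++ p (map (𝟚 ∷_) W) _) (cong₂ _+_ (count-map p (𝟚 ∷_) W) refl)))))
    where
    W : List (Word n)
    W = words n

  count-ascends-suc : ∀ s n → count (ascends s) (words (suc n)) ≡ 3 ^ n + count (ascends s) (words n)
  count-ascends-suc s n = trans (count-words-suc {n} (ascends s)) (blocks s)
    where
    W : List (Word n)
    W = words n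
    all : ∀ s i → (∀ w → ascends s (i ∷ w) ≡ true) → count (ascends s ∘ (i ∷_)) W ≡ 3 ^ n
    all s i always = trans (count-true always W) (length-words n)
    none : ∀ s i → (∀ w → ascends s (i ∷ w) ≡ false) → count (ascends s ∘ (i ∷_)) W ≡ 0
    none s i never = count-false never W
    same : ∀ s i → (∀ w → ascends s (i ∷ w) ≡ ascends s w) → count (ascends s ∘ (i ∷_)) W ≡ count (ascends s) W
    same s i p≗ = count-cong p≗ W
    -- On the words i ∷ w the generator s only changes the first letter, unless s fixes i:
    -- the block of the smaller letter of the pair moved by s always ascends, the other never.
    blocks : ∀ s → count (ascends s ∘ (𝟘 ∷_)) W + (count (ascends s ∘ (𝟙 ∷_)) W + (count (ascends s ∘ (𝟚 ∷_)) W + 0))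
                     ≡ 3 ^ n + count (ascends s) W
    blocks a = trans
      (cong₂ _+_ (all a 𝟘 λ w → <ᵇ-true (N.n<1+n (3 * code w)))
        (cong₂ _+_ (none a 𝟙 λ w → <ᵇ-false (N.n≤1+n (3 * code w)))
          (cong (_+ 0) (same a 𝟚 λ w → *-<ᵇ 3 (code w) (code (act a w))))))
      (cong (3 ^ n +_) (N.+-identityʳ _))
    blocks b = trans
      (cong₂ _+_ (all b 𝟘 λ w → <ᵇ-true (N.m<n+m (3 * code w) {2} z<s))
        (cong₂ _+_ (same b 𝟙 λ w → *-<ᵇ 3 (code w) (code (act b w)))
          (cong (_+ 0) (none b 𝟚 λ w → <ᵇ-false (N.m≤n+m (3 * code w) 2)))))
      (cong (3 ^ n +_) (N.+-identityʳ _))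
    blocks c = trans
      (cong₂ _+_ (same c 𝟘 λ w → *-<ᵇ 3 (code w) (code (act c w)))
        (cong₂ _+_ (all c 𝟙 λ w → <ᵇ-true (N.n<1+n (3 * code w)))
          (cong (_+ 0) (none c 𝟚 λ w → <ᵇ-false (N.n≤1+n (3 * code w))))))
      (trans (cong (count (ascends c) W +_) (N.+-identityʳ (3 ^ n))) (N.+-comm _ (3 ^ n)))

  count-ascends : ∀ s n → 2 * count (ascends s) (words n) + 1 ≡ 3 ^ n
  count-ascends s zero = refl
  count-ascends s (suc n) = trans (cong (λ k → 2 * k + 1) (count-ascends-suc s n)) (step (count-ascends s n))
    where
    open import Data.Nat.Tactic.RingSolver
    step : ∀ {k t} → 2 * k + 1 ≡ t → 2 * (t + k) + 1 ≡ 3 * t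
    step {k} refl = lemma k
      where
      lemma : ∀ k → 2 * ((2 * k + 1) + k) + 1 ≡ 3 * (2 * k + 1)
      lemma = solve-∀

  length-edges : ∀ n → length (edges n) ≡ (3 ^ (n + 1) ∸ 3) / 2
  length-edges n = sym (begin
    (3 ^ (n + 1) ∸ 3) / 2 ≡⟨ cong (λ t → (t ∸ 3) / 2) three-pow ⟩
    (2 * E + 3 ∸ 3) / 2   ≡⟨ cong (_/ 2) (N.m+n∸n≡m (2 * E) 3) ⟩
    2 * E / 2             ≡⟨ cong (_/ 2) (N.*-comm 2 E) ⟩
    E * 2 / 2             ≡⟨ m*n/n≡m E 2 ⟩
    E                     ≡⟨ count-edges (words n) ⟨
    length (edges n)      ∎)
    where
    open ≡.≡-Reasoning
    open import Data.Nat.Tactic.RingSolver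
    ca cb cc E : ℕ
    ca = count (ascends a) (words n)
    cb = count (ascends b) (words n)
    cc = count (ascends c) (words n)
    E = ca + (cb + cc)
    three-pow : 3 ^ (n + 1) ≡ 2 * E + 3
    three-pow = begin
      3 ^ (n + 1)
        ≡⟨ cong (3 ^_) (N.+-comm n 1) ⟩
      3 ^ n + (3 ^ n + (3 ^ n + 0))
        ≡⟨ cong₂ _+_ (count-ascends a n) (cong₂ _+_ (count-ascends b n) (cong (_+ 0) (count-ascends c n))) ⟨
      (2 * ca + 1) + ((2 * cb + 1) + ((2 * cc + 1) + 0))
        ≡⟨ lemma ca cb cc ⟩
      2 * E + 3 ∎
      where
      lemma : ∀ x y z → (2 * x + 1) + ((2 * y + 1) + ((2 * z + 1) + 0)) ≡ 2 * (x + (y + z)) + 3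
      lemma = solve-∀

  edges-loopless : ∀ n {e} → e ∈ edges n → sameVertex (end₁ e) (end₂ e) ≡ false
  edges-loopless n {s , u} e∈ = sameVertex-≢ {u = u} {act s u} λ u≡su →
    N.<-irrefl (cong code u≡su) (N.<ᵇ⇒< (code u) (code (act s u)) (Equivalence.from T-≡ ascending))
    where
    ascending : ascends s u ≡ true
    ascending = ∈-filterᵇ⁻ (λ e → ascends (proj₁ e) (proj₂ e)) (concatMap candidates (words n)) e∈

open Edges

module Ising {ℓ₁ ℓ₂} (R : CommutativeRing ℓ₁ ℓ₂) where
  open CommutativeRing R
  open ListSums R
  open import Relation.Binary.Reasoning.Setoid setoid
  open import Algebra.Properties.Ring ring using (-1*x≈-x; -‿involutive; -‿distribʳ-*)
  open import Algebra.Properties.CommutativeSemigroup *-commutativeSemigroup using (x∙yz≈yx∙z)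
    renaming (interchange to *-interchange)
  open import Algebra.Properties.CommutativeSemigroup +-commutativeSemigroup using ()
    renaming (interchange to +-interchange)

  edgeWeight : Carrier → Carrier → Bool → Bool → Carrier
  edgeWeight x y p q = if agree R p q then x else y

  boltzmann : ∀ {n} → Carrier → Carrier → (Word n → Bool) → Carrier
  boltzmann {n} x y σ = ∏ (edges n) (λ e → edgeWeight x y (σ (end₁ e)) (σ (end₂ e)))

  boltzmann-cong : ∀ {n} x y {σ τ : Word n → Bool} → (∀ u → σ u ≡ τ u) → boltzmann x y σ ≈ boltzmann x y τ
  boltzmann-cong {n} x y σ≗τ =
    ∏-cong (edges n) (λ e → reflexive (≡.cong₂ (edgeWeight x y) (σ≗τ (end₁ e)) (σ≗τ (end₂ e))))

  signOf : Bool → Carrier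
  signOf true = - 1#
  signOf false = 1#

  bondSign : ∀ {n} → (Word n → Bool) → Edge n → Carrier
  bondSign σ e = signOf (σ (end₁ e)) * signOf (σ (end₂ e))

  parity : ℕ → Carrier
  parity k = if isEven k then 1# else - 1#

  -1*-1≈1 : - 1# * - 1# ≈ 1#
  -1*-1≈1 = trans (-1*x≈-x (- 1#)) (-‿involutive 1#)

  signOf-xor : ∀ p q → signOf (p xor q) ≈ signOf p * signOf q
  signOf-xor false q = sym (*-identityˡ _)
  signOf-xor true false = sym (*-identityʳ _)
  signOf-xor true true = sym -1*-1≈1

  agree-weight : ∀ z p q → edgeWeight (1# + z) (1# - z) p q ≈ 1# + z * (signOf p * signOf q)
  agree-weight z p q = trans (weight p q) (+-congˡ (*-congˡ (signOf-xor p q)))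
    where
    z*-1≈-z : z * - 1# ≈ - z
    z*-1≈-z = trans (sym (-‿distribʳ-* z 1#)) (-‿cong (*-identityʳ z))
    weight : ∀ p q → (if agree R p q then 1# + z else 1# - z) ≈ 1# + z * signOf (p xor q)
    weight true true = +-congˡ (sym (*-identityʳ z))
    weight false false = +-congˡ (sym (*-identityʳ z))
    weight true false = +-congˡ (sym z*-1≈-z)
    weight false true = +-congˡ (sym z*-1≈-z)

  spinMinus-∉ : ∀ {n} (S : List (Word n)) {v} → (∀ {u} → u ∈ S → u ≢ v) → spinMinus R S v ≡ false
  spinMinus-∉ [] v∉S = ≡.refl
  spinMinus-∉ (u ∷ S) v∉S rewrite sameVertex-≢ (v∉S (here ≡.refl)) = spinMinus-∉ S (v∉S ∘ there)

  spinMinus-↭ : ∀ {n} {S T : List (Word n)} → S ↭ T → ∀ u → spinMinus R S u ≡ spinMinus R T u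
  spinMinus-↭ ↭.refl u = ≡.refl
  spinMinus-↭ (↭.prep w p) u = ≡.cong (sameVertex w u ∨_) (spinMinus-↭ p u)
  spinMinus-↭ (↭.swap {xs} {ys} v w p) u =
    ≡.trans (≡.cong (λ r → sameVertex v u ∨ sameVertex w u ∨ r) (spinMinus-↭ p u))
            (∨-swap (sameVertex v u) (sameVertex w u) (spinMinus R ys u))
    where
    ∨-swap : ∀ p q r → p ∨ q ∨ r ≡ q ∨ p ∨ r
    ∨-swap true true r = ≡.refl
    ∨-swap true false r = ≡.refl
    ∨-swap false q r = ≡.refl
  spinMinus-↭ (↭.trans p q) u = ≡.trans (spinMinus-↭ p u) (spinMinus-↭ q u)

  spinMinus-++ : ∀ {n} (S T : List (Word n)) u → spinMinus R (S ++ T) u ≡ spinMinus R S u ∨ spinMinus R T u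
  spinMinus-++ [] T u = ≡.refl
  spinMinus-++ (w ∷ S) T u = ≡.trans (≡.cong (sameVertex w u ∨_) (spinMinus-++ S T u)) (≡.sym (∨-assoc (sameVertex w u) _ _))

  spinMinus-map-∷ʳ : ∀ {n} (S : List (Word n)) w i → spinMinus R (map (_∷ʳ i) S) (w ∷ʳ i) ≡ spinMinus R S w
  spinMinus-map-∷ʳ [] w i = ≡.refl
  spinMinus-map-∷ʳ (v ∷ S) w i =
    ≡.cong₂ _∨_ (sameVertex-injective (_∷ʳ i) (Vec.∷ʳ-injectiveˡ _ _) v w) (spinMinus-map-∷ʳ S w i)

  spinMinus-map-∷ʳ-≢ : ∀ {n} (S : List (Word n)) w {i j} → j ≢ i → spinMinus R (map (_∷ʳ j) S) (w ∷ʳ i) ≡ false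
  spinMinus-map-∷ʳ-≢ [] w j≢i = ≡.refl
  spinMinus-map-∷ʳ-≢ (v ∷ S) w j≢i =
    ≡.cong₂ _∨_ (sameVertex-≢ (j≢i ∘ Vec.∷ʳ-injectiveʳ v w)) (spinMinus-map-∷ʳ-≢ S w j≢i)

  spinMinus-byLastLetter : ∀ {n} (S : Fin 3 → List (Word n)) w i → spinMinus R (byLastLetter S) (w ∷ʳ i) ≡ spinMinus R (S i) w
  spinMinus-byLastLetter S w i = ≡.trans (spinMinus-++ (map (_∷ʳ 𝟘) (S 𝟘)) _ (w ∷ʳ i))
    (≡.trans (≡.cong (spinMinus R (map (_∷ʳ 𝟘) (S 𝟘)) (w ∷ʳ i) ∨_) (spinMinus-++ (map (_∷ʳ 𝟙) (S 𝟙)) _ (w ∷ʳ i)))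
             (pick-letter i))
    where
    pick-letter : ∀ i → spinMinus R (map (_∷ʳ 𝟘) (S 𝟘)) (w ∷ʳ i)
                          ∨ (spinMinus R (map (_∷ʳ 𝟙) (S 𝟙)) (w ∷ʳ i) ∨ spinMinus R (map (_∷ʳ 𝟚) (S 𝟚) ++ []) (w ∷ʳ i))
                        ≡ spinMinus R (S i) w
    pick-letter 𝟘
      rewrite spinMinus-map-∷ʳ (S 𝟘) w 𝟘 | spinMinus-map-∷ʳ-≢ (S 𝟙) w {𝟘} {𝟙} (λ ())
            | spinMinus-++ (map (_∷ʳ 𝟚) (S 𝟚)) [] (w ∷ʳ 𝟘) | spinMinus-map-∷ʳ-≢ (S 𝟚) w {𝟘} {𝟚} (λ ()) = ∨-identityʳ _
    pick-letter 𝟙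
      rewrite spinMinus-map-∷ʳ-≢ (S 𝟘) w {𝟙} {𝟘} (λ ()) | spinMinus-map-∷ʳ (S 𝟙) w 𝟙
            | spinMinus-++ (map (_∷ʳ 𝟚) (S 𝟚)) [] (w ∷ʳ 𝟙) | spinMinus-map-∷ʳ-≢ (S 𝟚) w {𝟙} {𝟚} (λ ()) = ∨-identityʳ _
    pick-letter 𝟚
      rewrite spinMinus-map-∷ʳ-≢ (S 𝟘) w {𝟚} {𝟘} (λ ()) | spinMinus-map-∷ʳ-≢ (S 𝟙) w {𝟚} {𝟙} (λ ())
            | spinMinus-++ (map (_∷ʳ 𝟚) (S 𝟚)) [] (w ∷ʳ 𝟚) | spinMinus-map-∷ʳ (S 𝟚) w 𝟚 = ∨-identityʳ _

  flip-spin : ∀ {n} (σ : Word n → Bool) v → σ v ≡ false → ∀ u → (sameVertex v u ∨ σ u) ≡ (sameVertex v u xor σ u)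
  flip-spin σ v σv≡false u with sameVertex v u in eq
  ... | true = ≡.sym (≡.cong not (≡.trans (≡.cong σ (≡.sym (sameVertex⇒≡ v u eq))) σv≡false))
  ... | false = ≡.refl

  incident-xor : ∀ {n} (v : Word n) (e : Edge n) → sameVertex (end₁ e) (end₂ e) ≡ false →
    incident v e ≡ sameVertex v (end₁ e) xor sameVertex v (end₂ e)
  incident-xor v e loopless with sameVertex v (end₁ e) in eq₁ | sameVertex v (end₂ e) in eq₂
  ... | true | true = ⊥-elim (false≢true (≡.trans (≡.sym loopless) (≡⇒sameVertex e₁≡e₂)))
    where
    e₁≡e₂ : end₁ e ≡ end₂ e
    e₁≡e₂ = ≡.trans (≡.sym (sameVertex⇒≡ v (end₁ e) eq₁)) (sameVertex⇒≡ v (end₂ e) eq₂)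
  ... | true | false = ≡.refl
  ... | false | _ = ≡.refl

  flip-bondSign : ∀ {n} (σ : Word n → Bool) v → σ v ≡ false → ∀ e → sameVertex (end₁ e) (end₂ e) ≡ false →
    bondSign (λ u → sameVertex v u ∨ σ u) e ≈ signOf (incident v e) * bondSign σ e
  flip-bondSign {n} σ v σv≡false e loopless = begin
    signOf (sv₁ ∨ σ e₁) * signOf (sv₂ ∨ σ e₂)
      ≡⟨ ≡.cong₂ (λ p q → signOf p * signOf q) (flip-spin σ v σv≡false e₁) (flip-spin σ v σv≡false e₂) ⟩
    signOf (sv₁ xor σ e₁) * signOf (sv₂ xor σ e₂)
      ≈⟨ *-cong (signOf-xor sv₁ (σ e₁)) (signOf-xor sv₂ (σ e₂)) ⟩
    (signOf sv₁ * signOf (σ e₁)) * (signOf sv₂ * signOf (σ e₂))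
      ≈⟨ *-interchange _ _ _ _ ⟩
    (signOf sv₁ * signOf sv₂) * bondSign σ e
      ≈⟨ *-congʳ (signOf-xor sv₁ sv₂) ⟨
    signOf (sv₁ xor sv₂) * bondSign σ e
      ≡⟨ ≡.cong (λ b → signOf b * bondSign σ e) (incident-xor v e loopless) ⟨
    signOf (incident v e) * bondSign σ e ∎
    where
    e₁ e₂ : Word n
    e₁ = end₁ e
    e₂ = end₂ e
    sv₁ sv₂ : Bool
    sv₁ = sameVertex v e₁
    sv₂ = sameVertex v e₂

  ∏-signOf-incident : ∀ {n} (v : Word n) (X : List (Edge n)) → ∏ X (λ e → signOf (incident v e)) ≈ parity (degree v X)
  ∏-signOf-incident v [] = refl
  ∏-signOf-incident v (e ∷ X) with incident v e
  ... | false = trans (*-identityˡ _) (∏-signOf-incident v X)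
  ... | true rewrite isEven-suc (degree v X) = trans (*-congˡ (∏-signOf-incident v X)) (negate (isEven (degree v X)))
    where
    negate : ∀ b → - 1# * (if b then 1# else - 1#) ≈ (if not b then 1# else - 1#)
    negate true = *-identityʳ _
    negate false = -1*-1≈1

  ∑-sublists-∏-bondSign : ∀ {n} (V : List (Word n)) → Unique V → (X : List (Edge n)) →
    (∀ {e} → e ∈ X → sameVertex (end₁ e) (end₂ e) ≡ false) →
    ∑ (sublists V) (λ S → ∏ X (bondSign (spinMinus R S))) ≈ ∏ V (λ v → 1# + parity (degree v X))
  ∑-sublists-∏-bondSign [] _ X _ = trans (+-identityʳ _) (trans (∏-cong X (λ _ → *-identityˡ 1#)) (∏-one X))
  ∑-sublists-∏-bondSign {n} (v ∷ V) (v∉V ∷ V-unique) X loopless = begin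
    ∑ (sublists (v ∷ V)) F
      ≈⟨ ∑-sublists-∷ v V F ⟩
    ∑ (sublists V) F + ∑ (sublists V) (F ∘ (v ∷_))
      ≈⟨ +-congˡ (∑-cong-∈ (sublists V) flip-v) ⟩
    ∑ (sublists V) F + ∑ (sublists V) (λ S → parity d * F S)
      ≈⟨ +-cong (*-identityˡ _) (*-distribˡ-∑ (sublists V) (parity d) F) ⟨
    1# * ∑ (sublists V) F + parity d * ∑ (sublists V) F
      ≈⟨ distribʳ _ _ _ ⟨
    (1# + parity d) * ∑ (sublists V) F
      ≈⟨ *-congˡ (∑-sublists-∏-bondSign V V-unique X loopless) ⟩
    (1# + parity d) * ∏ V (λ v → 1# + parity (degree v X)) ∎
    where
    F : List (Word n) → Carrier
    F S = ∏ X (bondSign (spinMinus R S))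
    d : ℕ
    d = degree v X
    flip-v : ∀ S → S ∈ sublists V → F (v ∷ S) ≈ parity d * F S
    flip-v S S⊆V = begin
      ∏ X (bondSign (λ u → sameVertex v u ∨ spinMinus R S u))
        ≈⟨ ∏-cong-∈ X (λ e e∈X → flip-bondSign (spinMinus R S) v v∉S e (loopless e∈X)) ⟩
      ∏ X (λ e → signOf (incident v e) * bondSign (spinMinus R S) e)
        ≈⟨ ∏-* X _ _ ⟩
      ∏ X (λ e → signOf (incident v e)) * F S
        ≈⟨ *-congʳ (∏-signOf-incident v X) ⟩
      parity d * F S ∎
      where
      v∉S : spinMinus R S v ≡ false
      v∉S = spinMinus-∉ S (λ u∈S u≡v → All.lookup v∉V (∈-sublists⇒⊆ V S⊆V u∈S) (≡.sym u≡v))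

  ∏-1+parity : ∀ {n} (V : List (Word n)) (X : List (Edge n)) →
    ∏ V (λ v → 1# + parity (degree v X)) ≈ (if allᵇ (λ v → isEven (degree v X)) V then pow R (1# + 1#) (length V) else 0#)
  ∏-1+parity [] X = refl
  ∏-1+parity (v ∷ V) X with isEven (degree v X)
  ... | true = trans (*-congˡ (∏-1+parity V X)) (double (allᵇ (λ v → isEven (degree v X)) V))
    where
    double : ∀ f → (1# + 1#) * (if f then pow R (1# + 1#) (length V) else 0#)
                   ≈ (if f then (1# + 1#) * pow R (1# + 1#) (length V) else 0#)
    double true = refl
    double false = zeroʳ _
  ... | false = trans (*-congʳ (-‿inverseʳ 1#)) (zeroˡ _)

  ∑-spins-∏-bondSign : ∀ n {X} → X ∈ sublists (edges n) →
    ∑ (sublists (words n)) (λ S → ∏ X (bondSign (spinMinus R S))) ≈ (if isClosed X then pow R (1# + 1#) (3 N.^ n) else 0#)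
  ∑-spins-∏-bondSign n {X} X⊆E = begin
    ∑ (sublists (words n)) (λ S → ∏ X (bondSign (spinMinus R S)))
      ≈⟨ ∑-sublists-∏-bondSign (words n) (words-unique n) X (edges-loopless n ∘ ∈-sublists⇒⊆ (edges n) X⊆E) ⟩
    ∏ (words n) (λ v → 1# + parity (degree v X))
      ≈⟨ ∏-1+parity (words n) X ⟩
    (if isClosed X then pow R (1# + 1#) (length (words n)) else 0#)
      ≡⟨ ≡.cong (λ k → if isClosed X then pow R (1# + 1#) k else 0#) (length-words n) ⟩
    (if isClosed X then pow R (1# + 1#) (3 N.^ n) else 0#) ∎

  highTemperatureExpansion : ∀ n z →
    ∑ (sublists (words n)) (λ S → boltzmann (1# + z) (1# - z) (spinMinus R S)) ≈ pow R (1# + 1#) (3 N.^ n) * Γcl R n z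
  highTemperatureExpansion n z = begin
    ∑ Ss (λ S → boltzmann (1# + z) (1# - z) (σ S))
      ≈⟨ ∑-cong Ss (λ S → ∏-cong E (λ e → agree-weight z _ _)) ⟩
    ∑ Ss (λ S → ∏ E (λ e → 1# + z * bondSign (σ S) e))
      ≈⟨ ∑-cong Ss (λ S → ∏-binomial z E (bondSign (σ S))) ⟩
    ∑ Ss (λ S → ∑ Xs (λ X → pow R z (length X) * ∏ X (bondSign (σ S))))
      ≈⟨ ∑-comm Ss Xs _ ⟩
    ∑ Xs (λ X → ∑ Ss (λ S → pow R z (length X) * ∏ X (bondSign (σ S))))
      ≈⟨ ∑-cong Xs (λ X → *-distribˡ-∑ Ss _ _) ⟨
    ∑ Xs (λ X → pow R z (length X) * ∑ Ss (λ S → ∏ X (bondSign (σ S))))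
      ≈⟨ ∑-cong-∈ Xs (λ X X⊆E → *-congˡ (∑-spins-∏-bondSign n X⊆E)) ⟩
    ∑ Xs (λ X → pow R z (length X) * (if isClosed X then K else 0#))
      ≈⟨ ∑-cong Xs (λ X → select (pow R z (length X)) (isClosed X)) ⟩
    ∑ Xs (λ X → if isClosed X then K * pow R z (length X) else 0#)
      ≈⟨ ∑-filter isClosed Xs _ ⟨
    ∑ (closedPolygons n) (λ X → K * pow R z (length X))
      ≈⟨ *-distribˡ-∑ (closedPolygons n) K _ ⟨
    K * Γcl R n z ∎
    where
    Ss : List (List (Word n))
    Ss = sublists (words n)
    E : List (Edge n)
    E = edges n
    Xs : List (List (Edge n))
    Xs = sublists E
    K : Carrier
    K = pow R (1# + 1#) (3 N.^ n)
    σ : List (Word n) → Word n → Bool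
    σ = spinMinus R
    select : ∀ w b → w * (if b then K else 0#) ≈ (if b then K * w else 0#)
    select w true = *-comm _ _
    select w false = zeroʳ _

  boltzmann-rescale : ∀ {n x y k t} → x ≈ k * (1# + t) → y ≈ k * (1# - t) → (σ : Word n → Bool) →
    boltzmann x y σ ≈ pow R k (length (edges n)) * boltzmann (1# + t) (1# - t) σ
  boltzmann-rescale {n} {x} {y} {k} {t} x≈ y≈ σ = begin
    ∏ E (λ e → if agree R (σ (end₁ e)) (σ (end₂ e)) then x else y)
      ≈⟨ ∏-cong E (λ e → rescale (agree R (σ (end₁ e)) (σ (end₂ e)))) ⟩
    ∏ E (λ e → k * (if agree R (σ (end₁ e)) (σ (end₂ e)) then 1# + t else 1# - t))
      ≈⟨ ∏-* E (λ _ → k) _ ⟩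
    ∏ E (λ _ → k) * boltzmann (1# + t) (1# - t) σ
      ≈⟨ *-congʳ (∏-const E k) ⟩
    pow R k (length E) * boltzmann (1# + t) (1# - t) σ ∎
    where
    E : List (Edge n)
    E = edges n
    rescale : ∀ b → (if b then x else y) ≈ k * (if b then 1# + t else 1# - t)
    rescale true = x≈
    rescale false = y≈

  module Halving {h : Carrier} (h*2≈1 : h * (1# + 1#) ≈ 1#) where

    h*[u+u]≈u : ∀ u → h * (u + u) ≈ u
    h*[u+u]≈u u = begin
      h * (u + u)         ≈⟨ *-congˡ (+-cong (*-identityˡ u) (*-identityˡ u)) ⟨
      h * (1# * u + 1# * u) ≈⟨ *-congˡ (distribʳ u 1# 1#) ⟨
      h * ((1# + 1#) * u) ≈⟨ *-assoc h _ u ⟨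
      (h * (1# + 1#)) * u ≈⟨ *-congʳ h*2≈1 ⟩
      1# * u              ≈⟨ *-identityˡ u ⟩
      u                   ∎

    h*[u+v]≈v+h*[u-v] : ∀ u v → h * (u + v) ≈ v + h * (u - v)
    h*[u+v]≈v+h*[u-v] u v = begin
      h * (u + v)                   ≈⟨ *-congˡ (+-identityʳ (u + v)) ⟨
      h * ((u + v) + 0#)            ≈⟨ *-congˡ (+-congˡ (-‿inverseʳ v)) ⟨
      h * ((u + v) + (v - v))       ≈⟨ *-congˡ (+-congʳ (+-comm u v)) ⟩
      h * ((v + u) + (v - v))       ≈⟨ *-congˡ (+-interchange v u v (- v)) ⟩
      h * ((v + v) + (u - v))       ≈⟨ distribˡ h _ _ ⟩
      h * (v + v) + h * (u - v)     ≈⟨ +-congʳ (h*[u+u]≈u v) ⟩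
      v + h * (u - v)               ∎

    h*[u+v]+h*[u-v]≈u : ∀ u v → h * (u + v) + h * (u - v) ≈ u
    h*[u+v]+h*[u-v]≈u u v = begin
      h * (u + v) + h * (u - v)     ≈⟨ distribˡ h _ _ ⟨
      h * ((u + v) + (u - v))       ≈⟨ *-congˡ (+-interchange u v u (- v)) ⟩
      h * ((u + u) + (v - v))       ≈⟨ *-congˡ (+-congˡ (-‿inverseʳ v)) ⟩
      h * ((u + u) + 0#)            ≈⟨ *-congˡ (+-identityʳ (u + u)) ⟩
      h * (u + u)                   ≈⟨ h*[u+u]≈u u ⟩
      u                             ∎

  isingZ-highTemperature : ∀ n (x y h k : Carrier) → h * (1# + 1#) ≈ 1# → k * (x + y) ≈ 1# →
    isingZ R n x y ≈ pow R (1# + 1#) (3 N.^ n) * pow R (h * (x + y)) ((3 N.^ (n N.+ 1) N.∸ 3) N./ 2) * Γcl R n ((x - y) * k)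
  isingZ-highTemperature n x y h k h*2≈1 k*[x+y]≈1 = begin
    ∑ Ss (λ S → boltzmann x y (σ S))
      ≈⟨ ∑-cong Ss (λ S → boltzmann-rescale x≈ y≈ (σ S)) ⟩
    ∑ Ss (λ S → pow R m (length E) * boltzmann (1# + t) (1# - t) (σ S))
      ≈⟨ *-distribˡ-∑ Ss _ _ ⟨
    pow R m (length E) * ∑ Ss (λ S → boltzmann (1# + t) (1# - t) (σ S))
      ≈⟨ *-congˡ (highTemperatureExpansion n t) ⟩
    pow R m (length E) * (K * Γcl R n t)
      ≈⟨ x∙yz≈yx∙z _ _ _ ⟩
    K * pow R m (length E) * Γcl R n t
      ≡⟨ ≡.cong (λ l → K * pow R m l * Γcl R n t) (length-edges n) ⟩
    K * pow R m ((3 N.^ (n N.+ 1) N.∸ 3) N./ 2) * Γcl R n t ∎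
    where
    open Halving h*2≈1
    Ss : List (List (Word n))
    Ss = sublists (words n)
    E : List (Edge n)
    E = edges n
    σ : List (Word n) → Word n → Bool
    σ = spinMinus R
    K m t : Carrier
    K = pow R (1# + 1#) (3 N.^ n)
    m = h * (x + y)
    t = (x - y) * k
    m*t≈h*[x-y] : m * t ≈ h * (x - y)
    m*t≈h*[x-y] = begin
      (h * (x + y)) * ((x - y) * k) ≈⟨ *-interchange h (x + y) (x - y) k ⟩
      (h * (x - y)) * ((x + y) * k) ≈⟨ *-congˡ (trans (*-comm (x + y) k) k*[x+y]≈1) ⟩
      (h * (x - y)) * 1#            ≈⟨ *-identityʳ _ ⟩
      h * (x - y)                   ∎
    x≈ : x ≈ m * (1# + t)
    x≈ = sym (begin
      m * (1# + t)              ≈⟨ distribˡ m 1# t ⟩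
      m * 1# + m * t            ≈⟨ +-cong (*-identityʳ m) m*t≈h*[x-y] ⟩
      h * (x + y) + h * (x - y) ≈⟨ h*[u+v]+h*[u-v]≈u x y ⟩
      x                         ∎)
    y≈ : y ≈ m * (1# - t)
    y≈ = sym (begin
      m * (1# - t)                            ≈⟨ distribˡ m 1# (- t) ⟩
      m * 1# + m * - t                        ≈⟨ +-cong (*-identityʳ m) (sym (-‿distribʳ-* m t)) ⟩
      m + - (m * t)                           ≈⟨ +-cong (h*[u+v]≈v+h*[u-v] x y) (-‿cong m*t≈h*[x-y]) ⟩
      (y + h * (x - y)) + - (h * (x - y))     ≈⟨ +-assoc y _ _ ⟩
      y + (h * (x - y) + - (h * (x - y)))     ≈⟨ +-congˡ (-‿inverseʳ _) ⟩
      y + 0#                                  ≈⟨ +-identityʳ y ⟩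
      y                                       ∎)

-- Stated over arbitrary operations so that the same expressions can be handed to the ring
-- solver as polynomials.
module GluingAlgebra {ℓ} {A : Set ℓ} (0ᴬ 1ᴬ : A) (_⊕_ _⊗_ : A → A → A) where

  pick : Bool → A → A
  pick f x = if f then x else 1ᴬ

  Bridges : Set
  Bridges = Bool × Bool × Bool

  allBridges : List Bridges
  allBridges = (false , false , false) ∷ (false , false , true) ∷ (false , true , false) ∷ (false , true , true)
             ∷ (true , false , false) ∷ (true , false , true) ∷ (true , true , false) ∷ (true , true , true) ∷ []

  sumBridges : (Bridges → A) → A
  sumBridges f = foldr _⊕_ 0ᴬ (map f allBridges)

  bridgeWeight : A → Bridges → A
  bridgeWeight z (fa , fb , fc) = pick fa z ⊗ (pick fb z ⊗ pick fc z)

  copyTerm : A → A → A → A → A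
  copyTerm W c₀ c₁ c₂ = W ⊗ (c₀ ⊗ (c₁ ⊗ c₂))

  -- A triple (fa , fb , fc) says which of the three edges joining the copies of Σ_n inside
  -- Σ_{n+1} are used: fa joins copies 0 and 1 at their corner 2, fb copies 0 and 2 at corner 1,
  -- fc copies 1 and 2 at corner 0.  Corner i of copy i is corner i of Σ_{n+1}.
  glueTerm : A → (F₀ F₁ F₂ : Bool → Bool → Bool → A) → Bool → Bool → Bool → Bridges → A
  glueTerm z F₀ F₁ F₂ e₀ e₁ e₂ (fa , fb , fc) =
    bridgeWeight z (fa , fb , fc) ⊗ (F₀ e₀ fb fa ⊗ (F₁ fc e₁ fa ⊗ F₂ fc fb e₂))

  glue₃ : A → (F₀ F₁ F₂ : Bool → Bool → Bool → A) → Bool → Bool → Bool → A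
  glue₃ z F₀ F₁ F₂ e₀ e₁ e₂ = sumBridges (glueTerm z F₀ F₁ F₂ e₀ e₁ e₂)

  glue : A → (Bool → Bool → Bool → A) → Bool → Bool → Bool → A
  glue z F = glue₃ z F F F

  bond : A → A → A → A
  bond z p q = 1ᴬ ⊕ (z ⊗ (p ⊗ q))

  -- Wᵢ is the weight of copy i, Eᵢ its factor at the outer corner i, qᵢⱼ its spin sign at corner j.
  bondedCopies bridgeExpansion : (z W₀ W₁ W₂ E₀ E₁ E₂ q₀₁ q₀₂ q₁₀ q₁₂ q₂₀ q₂₁ : A) → A
  bondedCopies z W₀ W₁ W₂ E₀ E₁ E₂ q₀₁ q₀₂ q₁₀ q₁₂ q₂₀ q₂₁ =
    ((W₀ ⊗ (W₁ ⊗ (W₂ ⊗ 1ᴬ))) ⊗ (bond z q₀₂ q₁₂ ⊗ (bond z q₀₁ q₂₁ ⊗ bond z q₁₀ q₂₀))) ⊗ (E₀ ⊗ (E₁ ⊗ E₂))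
  bridgeExpansion z W₀ W₁ W₂ E₀ E₁ E₂ q₀₁ q₀₂ q₁₀ q₁₂ q₂₀ q₂₁ = sumBridges term
    where
    term : Bridges → A
    term (fa , fb , fc) = bridgeWeight z (fa , fb , fc)
      ⊗ (copyTerm W₀ E₀ (pick fb q₀₁) (pick fa q₀₂)
      ⊗ (copyTerm W₁ (pick fc q₁₀) E₁ (pick fa q₁₂)
      ⊗ copyTerm W₂ (pick fc q₂₀) (pick fb q₂₁) E₂))

  -- The number of odd corners is even, and the three pairs of corners play the same role.
  cornerPattern : A → A → Bool → Bool → Bool → A
  cornerPattern G D false false false = G
  cornerPattern G D false true  true  = D
  cornerPattern G D true  false true  = D
  cornerPattern G D true  true  false = D
  cornerPattern G D false false true  = 0ᴬ
  cornerPattern G D false true  false = 0ᴬ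
  cornerPattern G D true  false false = 0ᴬ
  cornerPattern G D true  true  true  = 0ᴬ

  cornerPattern-same : ∀ G e₀ e₁ e₂ → cornerPattern G G e₀ e₁ e₂ ≡ (if e₀ xor (e₁ xor e₂) then 0ᴬ else G)
  cornerPattern-same G false false false = ≡.refl
  cornerPattern-same G false false true  = ≡.refl
  cornerPattern-same G false true  false = ≡.refl
  cornerPattern-same G false true  true  = ≡.refl
  cornerPattern-same G true  false false = ≡.refl
  cornerPattern-same G true  false true  = ≡.refl
  cornerPattern-same G true  true  false = ≡.refl
  cornerPattern-same G true  true  true  = ≡.refl

  closedStep pathStep : A → A → A → A
  closedStep z G D = (G ⊗ (G ⊗ G)) ⊕ ((z ⊗ (z ⊗ z)) ⊗ (D ⊗ (D ⊗ D)))
  pathStep z G D = (z ⊗ (D ⊗ (D ⊗ G))) ⊕ ((z ⊗ z) ⊗ (D ⊗ (D ⊗ D)))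

module Gluing {ℓ₁ ℓ₂} (R : CommutativeRing ℓ₁ ℓ₂) where
  open CommutativeRing R
  open ListSums R
  open Ising R
  open GluingAlgebra 0# 1# _+_ _*_ public
  open import Relation.Binary.Reasoning.Setoid setoid
  open import Algebra.Solver.Ring.NaturalCoefficients.Default commutativeSemiring
    using (solve; _:=_; Polynomial; con; _:+_; _:*_)
  private module Poly {n} = GluingAlgebra {A = Polynomial n} (con 0) (con 1) _:+_ _:*_

  private
    recurrence : Bool → Bool → Bool → (z G D : Polynomial 3) → Polynomial 3 × Polynomial 3
    recurrence e₀ e₁ e₂ z G D =
      Poly.glue z (Poly.cornerPattern G D) e₀ e₁ e₂ := Poly.cornerPattern (Poly.closedStep z G D) (Poly.pathStep z G D) e₀ e₁ e₂

  glue-cornerPattern : ∀ e₀ e₁ e₂ z G D →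
    glue z (cornerPattern G D) e₀ e₁ e₂ ≈ cornerPattern (closedStep z G D) (pathStep z G D) e₀ e₁ e₂
  glue-cornerPattern false false false = solve 3 (recurrence false false false) refl
  glue-cornerPattern false false true  = solve 3 (recurrence false false true ) refl
  glue-cornerPattern false true  false = solve 3 (recurrence false true  false) refl
  glue-cornerPattern false true  true  = solve 3 (recurrence false true  true ) refl
  glue-cornerPattern true  false false = solve 3 (recurrence true  false false) refl
  glue-cornerPattern true  false true  = solve 3 (recurrence true  false true ) refl
  glue-cornerPattern true  true  false = solve 3 (recurrence true  true  false) refl
  glue-cornerPattern true  true  true  = solve 3 (recurrence true  true  true ) refl

  bondedCopies≈bridgeExpansion : ∀ z W₀ W₁ W₂ E₀ E₁ E₂ q₀₁ q₀₂ q₁₀ q₁₂ q₂₀ q₂₁ →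
    bondedCopies z W₀ W₁ W₂ E₀ E₁ E₂ q₀₁ q₀₂ q₁₀ q₁₂ q₂₀ q₂₁
      ≈ bridgeExpansion z W₀ W₁ W₂ E₀ E₁ E₂ q₀₁ q₀₂ q₁₀ q₁₂ q₂₀ q₂₁
  bondedCopies≈bridgeExpansion = solve 13 (λ z W₀ W₁ W₂ E₀ E₁ E₂ q₀₁ q₀₂ q₁₀ q₁₂ q₂₀ q₂₁ →
      Poly.bondedCopies z W₀ W₁ W₂ E₀ E₁ E₂ q₀₁ q₀₂ q₁₀ q₁₂ q₂₀ q₂₁
        := Poly.bridgeExpansion z W₀ W₁ W₂ E₀ E₁ E₂ q₀₁ q₀₂ q₁₀ q₁₂ q₂₀ q₂₁) refl

  copy : ∀ {n} → (Word (suc n) → Bool) → Fin 3 → Word n → Bool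
  copy σ i w = σ (w ∷ʳ i)

  ∏-words-suc : ∀ {n} (g : Word (suc n) → Carrier) →
    ∏ (words (suc n)) g ≈ ∏ letters (λ i → ∏ (words n) (λ w → g (i ∷ w)))
  ∏-words-suc {n} g = trans (∏-concatMap (λ i → map (i ∷_) (words n)) letters g)
                            (∏-cong letters (λ i → reflexive (∏-map (i ∷_) (words n) g)))

  ∏-fixedWord : ∀ s n (φ : Word n → Carrier) →
    ∏ (words n) (λ w → if isFixedWord s w then φ w else 1#) ≈ φ (corner n (fixedLetter s))
  ∏-fixedWord s zero φ = *-identityʳ _
  ∏-fixedWord a (suc n) φ = trans (∏-words-suc {n} (λ w → if isFixedWord a w then φ w else 1#))
    (trans (*-cong (∏-one (words n)) (*-cong (∏-one (words n)) (*-congʳ (∏-fixedWord a n (φ ∘ (𝟚 ∷_))))))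
           (trans (*-identityˡ _) (trans (*-identityˡ _) (*-identityʳ _))))
  ∏-fixedWord b (suc n) φ = trans (∏-words-suc {n} (λ w → if isFixedWord b w then φ w else 1#))
    (trans (*-cong (∏-one (words n)) (*-cong (∏-fixedWord b n (φ ∘ (𝟙 ∷_))) (*-congʳ (∏-one (words n)))))
           (trans (*-identityˡ _) (trans (*-congˡ (*-identityʳ _)) (*-identityʳ _))))
  ∏-fixedWord c (suc n) φ = trans (∏-words-suc {n} (λ w → if isFixedWord c w then φ w else 1#))
    (trans (*-cong (∏-fixedWord c n (φ ∘ (𝟘 ∷_))) (*-cong (∏-one (words n)) (*-congʳ (∏-one (words n)))))
           (trans (*-congˡ (trans (*-identityˡ _) (*-identityʳ _))) (*-identityʳ _)))

  module SelfSimilarity (x y : Carrier) where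

    orientedWeight : ∀ {n} → (Word n → Bool) → Word n → Word n → Carrier
    orientedWeight σ u v = if code u <ᵇ code v then edgeWeight x y (σ u) (σ v) else 1#

    boltzmann-byVertex : ∀ {n} (σ : Word n → Bool) →
      boltzmann x y σ ≈ ∏ (words n) (λ u → ∏ generators (λ s → orientedWeight σ u (act s u)))
    boltzmann-byVertex {n} σ = trans (∏-filter _ (concatMap candidates (words n)) _) (∏-concatMap candidates (words n) _)

    orientedWeight-refl : ∀ {n} (σ : Word n → Bool) u → orientedWeight σ u u ≡ 1#
    orientedWeight-refl σ u = ≡.cong (λ f → if f then edgeWeight x y (σ u) (σ u) else 1#) (<ᵇ-false (N.≤-refl {code u}))

    orientedWeight-∷ʳ : ∀ {n} (σ : Word (suc n) → Bool) (w v : Word n) i →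
      orientedWeight σ (w ∷ʳ i) (v ∷ʳ i) ≡ orientedWeight (copy σ i) w v
    orientedWeight-∷ʳ {n} σ w v i = ≡.cong (λ f → if f then edgeWeight x y (σ (w ∷ʳ i)) (σ (v ∷ʳ i)) else 1#)
      (≡.trans (≡.cong₂ _<ᵇ_ (code-∷ʳ w i) (code-∷ʳ v i)) (+-<ᵇ (3 N.^ n N.* toℕ i) (code w) (code v)))

    orientedWeight-corner : ∀ {n} (σ : Word (suc n) → Bool) (r : Word n) i j →
      orientedWeight σ (r ∷ʳ i) (r ∷ʳ j) ≡ (if toℕ i <ᵇ toℕ j then edgeWeight x y (σ (r ∷ʳ i)) (σ (r ∷ʳ j)) else 1#)
    orientedWeight-corner {n} σ r i j = ≡.cong (λ f → if f then edgeWeight x y (σ (r ∷ʳ i)) (σ (r ∷ʳ j)) else 1#)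
      (≡.trans (≡.cong₂ _<ᵇ_ (code-∷ʳ r i) (code-∷ʳ r j))
        (≡.trans (+ʳ-<ᵇ (code r) (3 N.^ n N.* toℕ i) (3 N.^ n N.* toℕ j))
                 (*-<ᵇ (3 N.^ n) {{N.m^n≢0 3 n}} (toℕ i) (toℕ j))))

    orientedWeight-act-∷ʳ : ∀ {n} (σ : Word (suc n) → Bool) s (w : Word n) i →
      orientedWeight σ (w ∷ʳ i) (act s (w ∷ʳ i))
        ≈ orientedWeight (copy σ i) w (act s w) * (if isFixedWord s w then orientedWeight σ (w ∷ʳ i) (act s (w ∷ʳ i)) else 1#)
    orientedWeight-act-∷ʳ σ s w i with isFixedWord s w in fixed
    ... | true = begin
      orientedWeight σ (w ∷ʳ i) (act s (w ∷ʳ i))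
        ≈⟨ *-identityˡ _ ⟨
      1# * orientedWeight σ (w ∷ʳ i) (act s (w ∷ʳ i))
        ≡⟨ ≡.cong (_* orientedWeight σ (w ∷ʳ i) (act s (w ∷ʳ i))) loop ⟨
      orientedWeight (copy σ i) w (act s w) * orientedWeight σ (w ∷ʳ i) (act s (w ∷ʳ i)) ∎
      where
      loop : orientedWeight (copy σ i) w (act s w) ≡ 1#
      loop = ≡.trans (≡.cong (orientedWeight (copy σ i) w) (act-fixedWord s w fixed)) (orientedWeight-refl (copy σ i) w)
    ... | false = begin
      orientedWeight σ (w ∷ʳ i) (act s (w ∷ʳ i))             ≡⟨ ≡.cong (orientedWeight σ (w ∷ʳ i)) act-w∷ʳi ⟩
      orientedWeight σ (w ∷ʳ i) (act s w ∷ʳ i)               ≡⟨ orientedWeight-∷ʳ σ w (act s w) i ⟩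
      orientedWeight (copy σ i) w (act s w)                  ≈⟨ *-identityʳ _ ⟨
      orientedWeight (copy σ i) w (act s w) * 1#             ∎
      where
      act-w∷ʳi : act s (w ∷ʳ i) ≡ act s w ∷ʳ i
      act-w∷ʳi = ≡.trans (act-∷ʳ s w i) (≡.cong (λ f → act s w ∷ʳ (if f then actLetter s i else i)) fixed)

    cornerFactor : ∀ {n} → (Word (suc n) → Bool) → Gen → Fin 3 → Carrier
    cornerFactor {n} σ s i = orientedWeight σ (corner n (fixedLetter s) ∷ʳ i) (act s (corner n (fixedLetter s) ∷ʳ i))

    ∏-copy : ∀ {n} (σ : Word (suc n) → Bool) i →
      ∏ (words n) (λ w → ∏ generators (λ s → orientedWeight σ (w ∷ʳ i) (act s (w ∷ʳ i))))
        ≈ boltzmann x y (copy σ i) * ∏ generators (λ s → cornerFactor σ s i)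
    ∏-copy {n} σ i = begin
      ∏ W (λ w → ∏ generators (λ s → orientedWeight σ (w ∷ʳ i) (act s (w ∷ʳ i))))
        ≈⟨ ∏-cong W (λ w → ∏-cong generators (λ s → orientedWeight-act-∷ʳ σ s w i)) ⟩
      ∏ W (λ w → ∏ generators (λ s → inCopy s w * atCorner s w))
        ≈⟨ ∏-cong W (λ w → ∏-* generators (λ s → inCopy s w) (λ s → atCorner s w)) ⟩
      ∏ W (λ w → ∏ generators (λ s → inCopy s w) * ∏ generators (λ s → atCorner s w))
        ≈⟨ ∏-* W _ _ ⟩
      ∏ W (λ w → ∏ generators (λ s → inCopy s w)) * ∏ W (λ w → ∏ generators (λ s → atCorner s w))
        ≈⟨ *-cong (sym (boltzmann-byVertex (copy σ i))) (∏-comm W generators (λ w s → atCorner s w)) ⟩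
      boltzmann x y (copy σ i) * ∏ generators (λ s → ∏ W (atCorner s))
        ≈⟨ *-congˡ (∏-cong generators (λ s → ∏-fixedWord s n (λ w → orientedWeight σ (w ∷ʳ i) (act s (w ∷ʳ i))))) ⟩
      boltzmann x y (copy σ i) * ∏ generators (λ s → cornerFactor σ s i) ∎
      where
      W : List (Word n)
      W = words n
      inCopy : Gen → Word n → Carrier
      inCopy s w = orientedWeight (copy σ i) w (act s w)
      atCorner : Gen → Word n → Carrier
      atCorner s w = if isFixedWord s w then orientedWeight σ (w ∷ʳ i) (act s (w ∷ʳ i)) else 1#

    bridges : ∀ {n} → (Word (suc n) → Bool) → Carrier
    bridges {n} σ = edgeWeight x y (σ (corner n 𝟚 ∷ʳ 𝟘)) (σ (corner n 𝟚 ∷ʳ 𝟙))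
                  * (edgeWeight x y (σ (corner n 𝟙 ∷ʳ 𝟘)) (σ (corner n 𝟙 ∷ʳ 𝟚))
                  * edgeWeight x y (σ (corner n 𝟘 ∷ʳ 𝟙)) (σ (corner n 𝟘 ∷ʳ 𝟚)))

    ∏-cornerFactor : ∀ {n} (σ : Word (suc n) → Bool) →
      ∏ letters (λ i → ∏ generators (λ s → cornerFactor σ s i)) ≈ bridges σ
    ∏-cornerFactor {n} σ = trans (∏-cong letters (λ i → ∏-cong generators (λ s → reflexive (cornerFactor-≡ s i))))
      (solve 3 (λ p q r → (p :* (q :* (con 1 :* con 1)))
                          :* ((con 1 :* (con 1 :* (r :* con 1))) :* ((con 1 :* (con 1 :* (con 1 :* con 1))) :* con 1))
                         := p :* (q :* r)) refl _ _ _)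
      where
      cornerFactor-≡ : ∀ s i → cornerFactor σ s i ≡
        (if toℕ i <ᵇ toℕ (actLetter s i)
          then edgeWeight x y (σ (corner n (fixedLetter s) ∷ʳ i)) (σ (corner n (fixedLetter s) ∷ʳ actLetter s i)) else 1#)
      cornerFactor-≡ s i = ≡.trans (≡.cong (orientedWeight σ (corner n (fixedLetter s) ∷ʳ i)) (act-corner s i))
                                   (orientedWeight-corner σ (corner n (fixedLetter s)) i (actLetter s i))

    boltzmann-glue : ∀ {n} (σ : Word (suc n) → Bool) → boltzmann x y σ ≈ ∏ letters (boltzmann x y ∘ copy σ) * bridges σ
    boltzmann-glue {n} σ = begin
      boltzmann x y σ
        ≈⟨ boltzmann-byVertex σ ⟩
      ∏ (words (suc n)) atVertex
        ≈⟨ ∏-↭ atVertex (words-↭-byLastLetter n) ⟩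
      ∏ (byLastLetter (λ _ → W)) atVertex
        ≈⟨ ∏-concatMap (λ i → map (_∷ʳ i) W) letters atVertex ⟩
      ∏ letters (λ i → ∏ (map (_∷ʳ i) W) atVertex)
        ≈⟨ ∏-cong letters (λ i → trans (reflexive (∏-map (_∷ʳ i) W atVertex)) (∏-copy σ i)) ⟩
      ∏ letters (λ i → boltzmann x y (copy σ i) * ∏ generators (λ s → cornerFactor σ s i))
        ≈⟨ ∏-* letters (boltzmann x y ∘ copy σ) (λ i → ∏ generators (λ s → cornerFactor σ s i)) ⟩
      ∏ letters (boltzmann x y ∘ copy σ) * ∏ letters (λ i → ∏ generators (λ s → cornerFactor σ s i))
        ≈⟨ *-congˡ (∏-cornerFactor σ) ⟩
      ∏ letters (boltzmann x y ∘ copy σ) * bridges σ ∎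
      where
      W : List (Word n)
      W = words n
      atVertex : Word (suc n) → Carrier
      atVertex u = ∏ generators (λ s → orientedWeight σ u (act s u))

  glue₃-cong : ∀ z {F₀ F₁ F₂ G₀ G₁ G₂ : Bool → Bool → Bool → Carrier} →
    (∀ c₀ c₁ c₂ → F₀ c₀ c₁ c₂ ≈ G₀ c₀ c₁ c₂) → (∀ c₀ c₁ c₂ → F₁ c₀ c₁ c₂ ≈ G₁ c₀ c₁ c₂) →
    (∀ c₀ c₁ c₂ → F₂ c₀ c₁ c₂ ≈ G₂ c₀ c₁ c₂) →
    ∀ e₀ e₁ e₂ → glue₃ z F₀ F₁ F₂ e₀ e₁ e₂ ≈ glue₃ z G₀ G₁ G₂ e₀ e₁ e₂
  glue₃-cong z {F₀} {F₁} {F₂} {G₀} {G₁} {G₂} F₀≈ F₁≈ F₂≈ e₀ e₁ e₂ =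
    ∑-cong allBridges {glueTerm z F₀ F₁ F₂ e₀ e₁ e₂} {glueTerm z G₀ G₁ G₂ e₀ e₁ e₂} λ where
    (fa , fb , fc) → *-congˡ (*-cong (F₀≈ e₀ fb fa) (*-cong (F₁≈ fc e₁ fa) (F₂≈ fc fb e₂)))

  ∑-glue₃ : ∀ {X : Set} (xs : List X) (F₀ F₁ F₂ : X → Bool → Bool → Bool → Carrier) z e₀ e₁ e₂ →
    ∑ xs (λ x₀ → ∑ xs (λ x₁ → ∑ xs (λ x₂ → glue₃ z (F₀ x₀) (F₁ x₁) (F₂ x₂) e₀ e₁ e₂)))
      ≈ glue₃ z (λ c₀ c₁ c₂ → ∑ xs (λ x → F₀ x c₀ c₁ c₂)) (λ c₀ c₁ c₂ → ∑ xs (λ x → F₁ x c₀ c₁ c₂))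
                (λ c₀ c₁ c₂ → ∑ xs (λ x → F₂ x c₀ c₁ c₂)) e₀ e₁ e₂
  ∑-glue₃ {X} xs F₀ F₁ F₂ z e₀ e₁ e₂ = begin
    ∑ xs (λ x₀ → ∑ xs (λ x₁ → ∑ xs (λ x₂ → ∑ allBridges (term x₀ x₁ x₂))))
      ≈⟨ ∑-cong xs (λ x₀ → ∑-cong xs (λ x₁ → ∑-comm xs allBridges (term x₀ x₁))) ⟩
    ∑ xs (λ x₀ → ∑ xs (λ x₁ → ∑ allBridges (λ f → ∑ xs (λ x₂ → term x₀ x₁ x₂ f))))
      ≈⟨ ∑-cong xs (λ x₀ → ∑-comm xs allBridges (λ x₁ f → ∑ xs (λ x₂ → term x₀ x₁ x₂ f))) ⟩
    ∑ xs (λ x₀ → ∑ allBridges (λ f → ∑ xs (λ x₁ → ∑ xs (λ x₂ → term x₀ x₁ x₂ f))))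
      ≈⟨ ∑-comm xs allBridges (λ x₀ f → ∑ xs (λ x₁ → ∑ xs (λ x₂ → term x₀ x₁ x₂ f))) ⟩
    ∑ allBridges (λ f → ∑ xs (λ x₀ → ∑ xs (λ x₁ → ∑ xs (λ x₂ → term x₀ x₁ x₂ f))))
      ≈⟨ ∑-cong allBridges {λ f → ∑ xs (λ x₀ → ∑ xs (λ x₁ → ∑ xs (λ x₂ → term x₀ x₁ x₂ f)))}
                           {glueTerm z Σ₀ Σ₁ Σ₂ e₀ e₁ e₂} (λ where
           (fa , fb , fc) → ∑³-* xs xs xs (bridgeWeight z (fa , fb , fc))
                                 (λ x → F₀ x e₀ fb fa) (λ x → F₁ x fc e₁ fa) (λ x → F₂ x fc fb e₂)) ⟩
    glue₃ z Σ₀ Σ₁ Σ₂ e₀ e₁ e₂ ∎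
    where
    term : X → X → X → Bridges → Carrier
    term x₀ x₁ x₂ = glueTerm z (F₀ x₀) (F₁ x₁) (F₂ x₂) e₀ e₁ e₂
    Σ₀ Σ₁ Σ₂ : Bool → Bool → Bool → Carrier
    Σ₀ c₀ c₁ c₂ = ∑ xs (λ x → F₀ x c₀ c₁ c₂)
    Σ₁ c₀ c₁ c₂ = ∑ xs (λ x → F₁ x c₀ c₁ c₂)
    Σ₂ c₀ c₁ c₂ = ∑ xs (λ x → F₂ x c₀ c₁ c₂)

  ∑-sublists-byLastLetter : ∀ {n} (W : List (Word n)) (Φ : List (Word (suc n)) → Carrier) →
    ∑ (sublists (byLastLetter (λ _ → W))) Φ
      ≈ ∑ (sublists W) (λ S₀ → ∑ (sublists W) (λ S₁ → ∑ (sublists W) (λ S₂ → Φ (byLastLetter (triple S₀ S₁ S₂)))))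
  ∑-sublists-byLastLetter W Φ =
    trans (∑-sublists-map-++ (_∷ʳ 𝟘) W _ Φ) (∑-cong (sublists W) λ S₀ →
    trans (∑-sublists-map-++ (_∷ʳ 𝟙) W _ _) (∑-cong (sublists W) λ S₁ →
    trans (∑-sublists-map-++ (_∷ʳ 𝟚) W [] _) (∑-cong (sublists W) λ S₂ → +-identityʳ _)))

  module CornerSums (z : Carrier) where
    open SelfSimilarity (1# + z) (1# - z)

    cornerWeight : ∀ {n} → Bool → Bool → Bool → (Word n → Bool) → Carrier
    cornerWeight {n} e₀ e₁ e₂ τ = copyTerm (boltzmann (1# + z) (1# - z) τ)
      (pick e₀ (signOf (τ (corner n 𝟘)))) (pick e₁ (signOf (τ (corner n 𝟙)))) (pick e₂ (signOf (τ (corner n 𝟚))))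

    cornerWeight-cong : ∀ {n} {σ τ : Word n → Bool} → (∀ u → σ u ≡ τ u) → ∀ e₀ e₁ e₂ →
      cornerWeight e₀ e₁ e₂ σ ≈ cornerWeight e₀ e₁ e₂ τ
    cornerWeight-cong {n} {σ} {τ} σ≗τ e₀ e₁ e₂ = *-cong (boltzmann-cong (1# + z) (1# - z) σ≗τ)
      (reflexive (≡.cong₂ _*_ (atCorner e₀ 𝟘) (≡.cong₂ _*_ (atCorner e₁ 𝟙) (atCorner e₂ 𝟚))))
      where
      atCorner : ∀ e i → pick e (signOf (σ (corner n i))) ≡ pick e (signOf (τ (corner n i)))
      atCorner e i = ≡.cong (pick e ∘ signOf) (σ≗τ (corner n i))

    cornerWeight-glue : ∀ {n} (σ : Word (suc n) → Bool) e₀ e₁ e₂ →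
      cornerWeight e₀ e₁ e₂ σ
        ≈ glue₃ z (λ c₀ c₁ c₂ → cornerWeight c₀ c₁ c₂ (copy σ 𝟘)) (λ c₀ c₁ c₂ → cornerWeight c₀ c₁ c₂ (copy σ 𝟙))
                  (λ c₀ c₁ c₂ → cornerWeight c₀ c₁ c₂ (copy σ 𝟚)) e₀ e₁ e₂
    cornerWeight-glue {n} σ e₀ e₁ e₂ = begin
      cornerWeight e₀ e₁ e₂ σ
        ≈⟨ *-cong (boltzmann-glue σ)
                  (reflexive (≡.cong₂ _*_ (corner-copy e₀ 𝟘) (≡.cong₂ _*_ (corner-copy e₁ 𝟙) (corner-copy e₂ 𝟚)))) ⟩
      (∏ letters W * bridges σ) * (E 𝟘 e₀ * (E 𝟙 e₁ * E 𝟚 e₂))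
        ≈⟨ *-congʳ (*-congˡ (*-cong (agree-weight z _ _) (*-cong (agree-weight z _ _) (agree-weight z _ _)))) ⟩
      bondedCopies z (W 𝟘) (W 𝟙) (W 𝟚) (E 𝟘 e₀) (E 𝟙 e₁) (E 𝟚 e₂) (q 𝟘 𝟙) (q 𝟘 𝟚) (q 𝟙 𝟘) (q 𝟙 𝟚) (q 𝟚 𝟘) (q 𝟚 𝟙)
        ≈⟨ bondedCopies≈bridgeExpansion z (W 𝟘) (W 𝟙) (W 𝟚) (E 𝟘 e₀) (E 𝟙 e₁) (E 𝟚 e₂)
                                        (q 𝟘 𝟙) (q 𝟘 𝟚) (q 𝟙 𝟘) (q 𝟙 𝟚) (q 𝟚 𝟘) (q 𝟚 𝟙) ⟩
      glue₃ z (λ c₀ c₁ c₂ → cornerWeight c₀ c₁ c₂ (copy σ 𝟘)) (λ c₀ c₁ c₂ → cornerWeight c₀ c₁ c₂ (copy σ 𝟙))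
              (λ c₀ c₁ c₂ → cornerWeight c₀ c₁ c₂ (copy σ 𝟚)) e₀ e₁ e₂ ∎
      where
      W : Fin 3 → Carrier
      W i = boltzmann (1# + z) (1# - z) (copy σ i)
      q : Fin 3 → Fin 3 → Carrier
      q i j = signOf (copy σ i (corner n j))
      E : Fin 3 → Bool → Carrier
      E i e = pick e (q i i)
      corner-copy : ∀ e i → pick e (signOf (σ (corner (suc n) i))) ≡ E i e
      corner-copy e i = ≡.cong (pick e ∘ signOf ∘ σ) (replicate-∷ʳ n i)

    cornerSum : ℕ → Bool → Bool → Bool → Carrier
    cornerSum n e₀ e₁ e₂ = ∑ (sublists (words n)) (λ S → cornerWeight e₀ e₁ e₂ (spinMinus R S))

    cornerSum-suc : ∀ n e₀ e₁ e₂ → cornerSum (suc n) e₀ e₁ e₂ ≈ glue z (cornerSum n) e₀ e₁ e₂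
    cornerSum-suc n e₀ e₁ e₂ = begin
      ∑ (sublists (words (suc n))) Φ
        ≈⟨ ∑-sublists-↭ Φ (λ S↭T → cornerWeight-cong (spinMinus-↭ S↭T) e₀ e₁ e₂) (words-↭-byLastLetter n) ⟩
      ∑ (sublists (byLastLetter (λ _ → words n))) Φ
        ≈⟨ ∑-sublists-byLastLetter (words n) Φ ⟩
      ∑ Ss (λ S₀ → ∑ Ss (λ S₁ → ∑ Ss (λ S₂ → Φ (byLastLetter (triple S₀ S₁ S₂)))))
        ≈⟨ ∑-cong Ss (λ S₀ → ∑-cong Ss (λ S₁ → ∑-cong Ss (λ S₂ → glued (triple S₀ S₁ S₂)))) ⟩
      ∑ Ss (λ S₀ → ∑ Ss (λ S₁ → ∑ Ss (λ S₂ → glue₃ z (copyWeight S₀) (copyWeight S₁) (copyWeight S₂) e₀ e₁ e₂)))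
        ≈⟨ ∑-glue₃ Ss copyWeight copyWeight copyWeight z e₀ e₁ e₂ ⟩
      glue z (cornerSum n) e₀ e₁ e₂ ∎
      where
      Ss : List (List (Word n))
      Ss = sublists (words n)
      Φ : List (Word (suc n)) → Carrier
      Φ S = cornerWeight e₀ e₁ e₂ (spinMinus R S)
      copyWeight : List (Word n) → Bool → Bool → Bool → Carrier
      copyWeight S c₀ c₁ c₂ = cornerWeight c₀ c₁ c₂ (spinMinus R S)
      glued : ∀ S → Φ (byLastLetter S) ≈ glue₃ z (copyWeight (S 𝟘)) (copyWeight (S 𝟙)) (copyWeight (S 𝟚)) e₀ e₁ e₂
      glued S = trans (cornerWeight-glue (spinMinus R (byLastLetter S)) e₀ e₁ e₂)
        (glue₃-cong z (inCopy 𝟘) (inCopy 𝟙) (inCopy 𝟚) e₀ e₁ e₂)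
        where
        inCopy : ∀ i c₀ c₁ c₂ →
          cornerWeight c₀ c₁ c₂ (copy (spinMinus R (byLastLetter S)) i) ≈ copyWeight (S i) c₀ c₁ c₂
        inCopy i = cornerWeight-cong (λ w → spinMinus-byLastLetter S w i)

    cornerSum-zero : ∀ e₀ e₁ e₂ → cornerSum 0 e₀ e₁ e₂ ≈ cornerPattern (1# + 1#) (1# + 1#) e₀ e₁ e₂
    cornerSum-zero e₀ e₁ e₂ = begin
      1# * (pick e₀ 1# * (pick e₁ 1# * pick e₂ 1#)) + (1# * (pick e₀ (- 1#) * (pick e₁ (- 1#) * pick e₂ (- 1#))) + 0#)
        ≡⟨ ≡.cong₂ (λ p m → 1# * p + (1# * m + 0#))
             (≡.cong₂ _*_ (pick-1 e₀) (≡.cong₂ _*_ (pick-1 e₁) (pick-1 e₂)))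
             (≡.cong₂ _*_ (pick-signOf e₀) (≡.cong₂ _*_ (pick-signOf e₁) (pick-signOf e₂))) ⟩
      1# * (1# * (1# * 1#)) + (1# * (signOf e₀ * (signOf e₁ * signOf e₂)) + 0#)
        ≈⟨ +-cong (trans (*-identityˡ _) (trans (*-identityˡ _) (*-identityˡ _))) (trans (+-identityʳ _) (*-identityˡ _)) ⟩
      1# + signOf e₀ * (signOf e₁ * signOf e₂)
        ≈⟨ +-congˡ (trans (signOf-xor e₀ (e₁ xor e₂)) (*-congˡ (signOf-xor e₁ e₂))) ⟨
      1# + signOf (e₀ xor (e₁ xor e₂))
        ≈⟨ 1+signOf (e₀ xor (e₁ xor e₂)) ⟩
      (if e₀ xor (e₁ xor e₂) then 0# else 1# + 1#)
        ≡⟨ cornerPattern-same (1# + 1#) e₀ e₁ e₂ ⟨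
      cornerPattern (1# + 1#) (1# + 1#) e₀ e₁ e₂ ∎
      where
      pick-1 : ∀ e → pick e 1# ≡ 1#
      pick-1 true = ≡.refl
      pick-1 false = ≡.refl
      pick-signOf : ∀ e → pick e (- 1#) ≡ signOf e
      pick-signOf true = ≡.refl
      pick-signOf false = ≡.refl
      1+signOf : ∀ b → 1# + signOf b ≈ (if b then 0# else 1# + 1#)
      1+signOf true = -‿inverseʳ 1#
      1+signOf false = refl

    closedSum pathSum : ℕ → Carrier
    closedSum zero = 1# + 1#
    closedSum (suc n) = closedStep z (closedSum n) (pathSum n)
    pathSum zero = 1# + 1#
    pathSum (suc n) = pathStep z (closedSum n) (pathSum n)

    cornerSum≈cornerPattern : ∀ n e₀ e₁ e₂ →
      cornerSum n e₀ e₁ e₂ ≈ cornerPattern (closedSum n) (pathSum n) e₀ e₁ e₂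
    cornerSum≈cornerPattern zero = cornerSum-zero
    cornerSum≈cornerPattern (suc n) e₀ e₁ e₂ = begin
      cornerSum (suc n) e₀ e₁ e₂                                        ≈⟨ cornerSum-suc n e₀ e₁ e₂ ⟩
      glue z (cornerSum n) e₀ e₁ e₂                                     ≈⟨ glue₃-cong z IH IH IH e₀ e₁ e₂ ⟩
      glue z (cornerPattern (closedSum n) (pathSum n)) e₀ e₁ e₂         ≈⟨ glue-cornerPattern e₀ e₁ e₂ z _ _ ⟩
      cornerPattern (closedSum (suc n)) (pathSum (suc n)) e₀ e₁ e₂      ∎
      where
      IH : ∀ e₀ e₁ e₂ → cornerSum n e₀ e₁ e₂ ≈ cornerPattern (closedSum n) (pathSum n) e₀ e₁ e₂
      IH = cornerSum≈cornerPattern n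

    closedPolygons≈closedSum : ∀ n → pow R (1# + 1#) (3 N.^ n) * Γcl R n z ≈ closedSum n
    closedPolygons≈closedSum n = begin
      pow R (1# + 1#) (3 N.^ n) * Γcl R n z
        ≈⟨ highTemperatureExpansion n z ⟨
      ∑ (sublists (words n)) (λ S → boltzmann (1# + z) (1# - z) (spinMinus R S))
        ≈⟨ ∑-cong (sublists (words n)) (λ S → no-corners _) ⟩
      cornerSum n false false false
        ≈⟨ cornerSum≈cornerPattern n false false false ⟩
      closedSum n ∎
      where
      no-corners : ∀ w → w ≈ w * (1# * (1# * 1#))
      no-corners w = sym (trans (*-congˡ (trans (*-identityˡ _) (*-identityˡ _))) (*-identityʳ w))

module ClosedForm where

  open import Data.Nat using (_^_; _∸_)
  open import Data.Integer using (+_)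
  open import Data.Rational using (1ℚ; _*_; _+_; _-_; 1/_; ½)
  import Data.Rational.Properties as Q
  open import Data.Rational.Solver using (module +-*-Solver)
  open import Data.Product using (proj₂)
  open import Relation.Binary.PropositionalEquality using (refl; sym; trans; cong; cong₂)
  open ≡.≡-Reasoning
  open +-*-Solver using (solve; _:=_; _:+_; _:*_; _:-_; con)

  cube : ℚ → ℚ
  cube x = x * (x * x)

  powℚ-+ : ∀ x m k → powℚ x (m N.+ k) ≡ powℚ x m * powℚ x k
  powℚ-+ x zero k = sym (Q.*-identityˡ _)
  powℚ-+ x (suc m) k = trans (cong (x *_) (powℚ-+ x m k)) (sym (Q.*-assoc x _ _))

  powℚ-3* : ∀ x k → powℚ x (3 N.* k) ≡ cube (powℚ x k)
  powℚ-3* x k = begin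
    powℚ x (k N.+ (k N.+ (k N.+ 0)))            ≡⟨ powℚ-+ x k _ ⟩
    powℚ x k * powℚ x (k N.+ (k N.+ 0))         ≡⟨ cong (powℚ x k *_) (powℚ-+ x k _) ⟩
    powℚ x k * (powℚ x k * powℚ x (k N.+ 0))    ≡⟨ cong (λ m → powℚ x k * (powℚ x k * powℚ x m)) (N.+-identityʳ k) ⟩
    cube (powℚ x k)                             ∎

  prodTo-cong : ∀ m {f g : ℕ → ℚ} → (∀ j → j ≤ m → f j ≡ g j) → prodTo m f ≡ prodTo m g
  prodTo-cong zero f≗g = refl
  prodTo-cong (suc m) f≗g = cong₂ _*_ (prodTo-cong m (λ j j≤m → f≗g j (N.m≤n⇒m≤1+n j≤m))) (f≗g (suc m) N.≤-refl)

  prodTo-cube : ∀ m (f : ℕ → ℚ) → prodTo m (λ j → cube (f j)) ≡ cube (prodTo m f)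
  prodTo-cube zero f = refl
  prodTo-cube (suc m) f = trans (cong (_* cube (f (suc m))) (prodTo-cube m f)) (cube-* (prodTo m f) (f (suc m)))
    where
    cube-* : ∀ x y → cube x * cube y ≡ cube (x * y)
    cube-* = solve 2 (λ x y → (x :* (x :* x)) :* (y :* (y :* y)) := (x :* y) :* ((x :* y) :* (x :* y))) refl

  module Solution (z : ℚ) .{{_ : NonZero z}} where
    open Gluing +-*-commutativeRing
    open CornerSums z

    ψProduct : ℕ → ℚ
    ψProduct n = prodTo n (λ j → powℚ (ψ j z) (3 ^ (n ∸ j)))

    ψProduct-suc : ∀ n → ψProduct (suc n) ≡ cube (ψProduct n) * ψ (suc n) z
    ψProduct-suc n = cong₂ _*_
      (trans (prodTo-cong n (λ j j≤n → trans (cong (λ k → powℚ (ψ j z) (3 ^ k)) (N.+-∸-assoc 1 j≤n))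
                                             (powℚ-3* (ψ j z) (3 ^ (n ∸ j)))))
             (prodTo-cube n (λ j → powℚ (ψ j z) (3 ^ (n ∸ j)))))
      (trans (cong (λ k → powℚ (ψ (suc n) z) (3 ^ k)) (N.n∸n≡0 n)) (Q.*-identityʳ _))

    -- The closed form of z * pathSum n.
    scale : ℕ → ℚ
    scale n = powℚ (1ℚ + 1ℚ) (3 ^ n) * (powℚ z (3 ^ n) * ψProduct n)

    scale-suc : ∀ n → scale (suc n) ≡ cube (scale n) * ψ (suc n) z
    scale-suc n = trans (cong₂ (λ t u → t * (u * ψProduct (suc n))) (powℚ-3* (1ℚ + 1ℚ) (3 ^ n)) (powℚ-3* z (3 ^ n)))
      (trans (cong (λ p → cube (powℚ (1ℚ + 1ℚ) (3 ^ n)) * (cube (powℚ z (3 ^ n)) * p)) (ψProduct-suc n))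
        (lemma (powℚ (1ℚ + 1ℚ) (3 ^ n)) (powℚ z (3 ^ n)) (ψProduct n) (ψ (suc n) z)))
      where
      lemma : ∀ t u p q → cube t * (cube u * (cube p * q)) ≡ cube (t * (u * p)) * q
      lemma = solve 4 (λ t u p q → (t :* (t :* t)) :* ((u :* (u :* u)) :* ((p :* (p :* p)) :* q))
                                 := ((t :* (u :* p)) :* ((t :* (u :* p)) :* (t :* (u :* p)))) :* q) refl

    recurrenceSolution : ∀ n → (z * pathSum n ≡ scale n) × (closedSum n ≡ scale n * (ψ (suc n) z - 1ℚ))
    recurrenceSolution zero = path₀ , closed₀
      where
      path₀ : z * ((1ℚ + 1ℚ)) ≡ ((1ℚ + 1ℚ) * 1ℚ) * ((z * 1ℚ) * 1ℚ)
      path₀ = solve 1 (λ z → z :* (con 1ℚ :+ con 1ℚ)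
                             := ((con 1ℚ :+ con 1ℚ) :* con 1ℚ) :* ((z :* con 1ℚ) :* con 1ℚ)) refl z
      closed₀ : 1ℚ + 1ℚ ≡ (((1ℚ + 1ℚ) * 1ℚ) * ((z * 1ℚ) * 1ℚ)) * ((z + 1ℚ) * (1/ z) - 1ℚ)
      closed₀ = sym (begin
        (((1ℚ + 1ℚ) * 1ℚ) * ((z * 1ℚ) * 1ℚ)) * ((z + 1ℚ) * (1/ z) - 1ℚ)
          ≡⟨ solve 2 (λ z w → (((con 1ℚ :+ con 1ℚ) :* con 1ℚ) :* ((z :* con 1ℚ) :* con 1ℚ)) :* ((z :+ con 1ℚ) :* w :- con 1ℚ)
                            := (con 1ℚ :+ con 1ℚ) :* ((z :+ con 1ℚ) :* (z :* w) :- z)) refl z (1/ z) ⟩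
        (1ℚ + 1ℚ) * ((z + 1ℚ) * (z * 1/ z) - z)
          ≡⟨ cong (λ t → (1ℚ + 1ℚ) * ((z + 1ℚ) * t - z)) (Q.*-inverseʳ z) ⟩
        (1ℚ + 1ℚ) * ((z + 1ℚ) * 1ℚ - z)
          ≡⟨ solve 1 (λ z → (con 1ℚ :+ con 1ℚ) :* ((z :+ con 1ℚ) :* con 1ℚ :- z) := con 1ℚ :+ con 1ℚ) refl z ⟩
        1ℚ + 1ℚ ∎)
    recurrenceSolution (suc n) with recurrenceSolution n
    ... | zD≡s , G≡s[p-1] = path , closed
      where
      G D s p : ℚ
      G = closedSum n
      D = pathSum n
      s = scale n
      p = ψ (suc n) z
      path : z * pathSum (suc n) ≡ scale (suc n)
      path = begin
        z * (z * (D * (D * G)) + (z * z) * (D * (D * D)))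
          ≡⟨ solve 3 (λ z D G → z :* (z :* (D :* (D :* G)) :+ (z :* z) :* (D :* (D :* D)))
                              := (z :* D) :* ((z :* D) :* (G :+ z :* D))) refl z D G ⟩
        (z * D) * ((z * D) * (G + z * D))
          ≡⟨ cong₂ (λ d g → d * (d * (g + d))) zD≡s G≡s[p-1] ⟩
        s * (s * (s * (p - 1ℚ) + s))
          ≡⟨ solve 2 (λ s p → s :* (s :* (s :* (p :- con 1ℚ) :+ s)) := (s :* (s :* s)) :* p) refl s p ⟩
        cube s * p
          ≡⟨ scale-suc n ⟨
        scale (suc n) ∎
      closed : closedSum (suc n) ≡ scale (suc n) * (ψ (suc (suc n)) z - 1ℚ)
      closed = begin
        G * (G * G) + (z * (z * z)) * (D * (D * D))
          ≡⟨ solve 3 (λ z D G → G :* (G :* G) :+ (z :* (z :* z)) :* (D :* (D :* D))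
                              := G :* (G :* G) :+ (z :* D) :* ((z :* D) :* (z :* D))) refl z D G ⟩
        G * (G * G) + (z * D) * ((z * D) * (z * D))
          ≡⟨ cong₂ (λ d g → g * (g * g) + d * (d * d)) zD≡s G≡s[p-1] ⟩
        s * (p - 1ℚ) * (s * (p - 1ℚ) * (s * (p - 1ℚ))) + s * (s * s)
          ≡⟨ solve 2 (λ s p → s :* (p :- con 1ℚ) :* (s :* (p :- con 1ℚ) :* (s :* (p :- con 1ℚ))) :+ s :* (s :* s)
                              := ((s :* (s :* s)) :* p) :* (p :* p :- con (+ 3 Q./ 1) :* p :+ con (+ 4 Q./ 1) :- con 1ℚ)) refl s p ⟩
        (cube s * p) * (p * p - (+ 3 Q./ 1) * p + (+ 4 Q./ 1) - 1ℚ)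
          ≡⟨ cong (_* (ψ (suc (suc n)) z - 1ℚ)) (scale-suc n) ⟨
        scale (suc n) * (ψ (suc (suc n)) z - 1ℚ) ∎

  pow≡powℚ : ∀ x k → pow +-*-commutativeRing x k ≡ powℚ x k
  pow≡powℚ x zero = refl
  pow≡powℚ x (suc k) = cong (x *_) (pow≡powℚ x k)

  powℚ-cancelˡ : ∀ {h t : ℚ} → h * t ≡ 1ℚ → ∀ k {x y} → powℚ t k * x ≡ powℚ t k * y → x ≡ y
  powℚ-cancelˡ {h} {t} h*t≡1 k {x} {y} eq = begin
    x                              ≡⟨ unit x ⟨
    powℚ h k * (powℚ t k * x)      ≡⟨ cong (powℚ h k *_) eq ⟩
    powℚ h k * (powℚ t k * y)      ≡⟨ unit y ⟩
    y                              ∎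
    where
    inverse : ∀ k → powℚ h k * powℚ t k ≡ 1ℚ
    inverse zero = refl
    inverse (suc k) = begin
      (h * powℚ h k) * (t * powℚ t k)
        ≡⟨ solve 4 (λ h t p q → (h :* p) :* (t :* q) := (h :* t) :* (p :* q)) refl h t (powℚ h k) (powℚ t k) ⟩
      (h * t) * (powℚ h k * powℚ t k)
        ≡⟨ cong₂ _*_ h*t≡1 (inverse k) ⟩
      1ℚ ∎
    unit : ∀ u → powℚ h k * (powℚ t k * u) ≡ u
    unit u = trans (sym (Q.*-assoc (powℚ h k) _ u)) (trans (cong (_* u) (inverse k)) (Q.*-identityˡ u))

  closedPolygonFormula : ∀ n (z : ℚ) .{{_ : NonZero z}} →
    Γcl +-*-commutativeRing n z ≡ (powℚ z (3 ^ n) * prodTo n (λ j → powℚ (ψ j z) (3 ^ (n ∸ j)))) * (ψ (n N.+ 1) z - 1ℚ)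
  closedPolygonFormula n z rewrite N.+-comm n 1 = powℚ-cancelˡ {½} refl (3 ^ n) (begin
    powℚ (1ℚ + 1ℚ) (3 ^ n) * Γcl +-*-commutativeRing n z
      ≡⟨ cong (_* Γcl +-*-commutativeRing n z) (pow≡powℚ (1ℚ + 1ℚ) (3 ^ n)) ⟨
    pow +-*-commutativeRing (1ℚ + 1ℚ) (3 ^ n) * Γcl +-*-commutativeRing n z
      ≡⟨ closedPolygons≈closedSum n ⟩
    closedSum n
      ≡⟨ proj₂ (recurrenceSolution n) ⟩
    scale n * (ψ (suc n) z - 1ℚ)
      ≡⟨ Q.*-assoc (powℚ (1ℚ + 1ℚ) (3 ^ n)) (powℚ z (3 ^ n) * ψProduct n) _ ⟩
    powℚ (1ℚ + 1ℚ) (3 ^ n) * ((powℚ z (3 ^ n) * ψProduct n) * (ψ (suc n) z - 1ℚ)) ∎)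
    where
    open Solution z
    open Gluing +-*-commutativeRing using (module CornerSums)
    open CornerSums z using (closedPolygons≈closedSum; closedSum)

mainTheorem7 : ∀ {ℓ₁ ℓ₂} (R : CommutativeRing ℓ₁ ℓ₂) (n : ℕ) → 1 ≤ n →
    (let open CommutativeRing R in
      ∀ (x y half k : Carrier) →
        x * y ≈ 1# → half * (1# + 1#) ≈ 1# → k * (x + y) ≈ 1# →
        isingZ R n x y
          ≈ pow R (1# + 1#) (3 N.^ n) * pow R (half * (x + y)) ((3 N.^ (n N.+ 1) N.∸ 3) N./ 2)
              * Γcl R n ((x - y) * k))
    ×
    (∀ (z : ℚ) .{{_ : NonZero z}} →
      Γcl +-*-commutativeRing n z
        ≡ (powℚ z (3 N.^ n) Q.* prodTo n (λ j → powℚ (ψ j z) (3 N.^ (n N.∸ j))))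
            Q.* (ψ (n N.+ 1) z Q.- Q.1ℚ))
mainTheorem7 R n _ = (λ x y h k _ → Ising.isingZ-highTemperature R n x y h k) , ClosedForm.closedPolygonFormula n
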